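{- Let $r$ be a power of an odd prime $p$, and let $Q$ be a power of $r$. Suppose $c\in\mathbb{F}_Q$ is nonzero and satisfies $\operatorname{Tr}_{\mathbb{F}_Q/\mathbb{F}_r}(c) = 0$, and let $e = (c^{r-1}+1)^{(r+1)/2}/c^{r(r-1)/2}$. Then the polynomial $(z^{r-1}+1)^{(r+1)/2} - e\,z^{r(r-1)/2}$ splits completely over $\mathbb{F}_Q$. -}

module Defs where

open import Level using (_⊔_) renaming (suc to lsuc)
open import Data.Nat using (ℕ; zero; suc)
import Data.Nat as ℕ
open import Data.List using (List; []; _∷_; map; foldr)
open import Data.Product using (∃; Σ-syntax; _×_; _,_)
open import Relation.Nullary using (¬_)
open import Algebra.Bundles using (CommutativeRing)

record Field c ℓ : Set (lsuc (c ⊔ ℓ)) where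
  field
    commutativeRing : CommutativeRing c ℓ
  open CommutativeRing commutativeRing public
  field
    1≉0     : ¬ (1# ≈ 0#)
    inverse : ∀ x → ¬ (x ≈ 0#) → ∃ λ y → x * y ≈ 1#

module FieldPoly {c ℓ} (F : Field c ℓ) where
  open Field F public

  infixr 8 _^ᶠ_
  _^ᶠ_ : Carrier → ℕ → Carrier
  x ^ᶠ zero  = 1#
  x ^ᶠ suc m = x * (x ^ᶠ m)

  sumᶠ : ℕ → (ℕ → Carrier) → Carrier
  sumᶠ zero    f = 0#
  sumᶠ (suc n) f = sumᶠ n f + f n

  -- Trace from F_Q to F_r, where Q = r^n:  Tr(x) = Σ_{i<n} x^(r^i)
  Tr : (r n : ℕ) → Carrier → Carrier
  Tr r n x = sumᶠ n (λ i → x ^ᶠ (r ℕ.^ i))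

  -- Polynomials over F as coefficient lists, lowest degree first.
  Poly : Set c
  Poly = List Carrier

  infixl 6 _+ₚ_ _-ₚ_
  infixl 7 _*ₚ_
  infixr 8 _^ₚ_

  _+ₚ_ : Poly → Poly → Poly
  []      +ₚ q       = q
  (a ∷ p) +ₚ []      = a ∷ p
  (a ∷ p) +ₚ (b ∷ q) = (a + b) ∷ (p +ₚ q)

  -ₚ_ : Poly → Poly
  -ₚ p = map -_ p

  _-ₚ_ : Poly → Poly → Poly
  p -ₚ q = p +ₚ (-ₚ q)

  _*ₚ_ : Poly → Poly → Poly
  []      *ₚ q = []
  (a ∷ p) *ₚ q = map (a *_) q +ₚ (0# ∷ (p *ₚ q))

  constₚ : Carrier → Poly
  constₚ a = a ∷ []

  1ₚ : Poly
  1ₚ = constₚ 1#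

  Xₚ : Poly
  Xₚ = 0# ∷ 1# ∷ []

  _^ₚ_ : Poly → ℕ → Poly
  p ^ₚ zero  = 1ₚ
  p ^ₚ suc m = p *ₚ (p ^ₚ m)

  coeff : Poly → ℕ → Carrier
  coeff []      i       = 0#
  coeff (a ∷ p) zero    = a
  coeff (a ∷ p) (suc i) = coeff p i

  infix 4 _≈ₚ_
  _≈ₚ_ : Poly → Poly → Set ℓ
  p ≈ₚ q = ∀ i → coeff p i ≈ coeff q i

  prodₚ : List Poly → Poly
  prodₚ = foldr _*ₚ_ 1ₚ

  Splits : Poly → Set (c ⊔ ℓ)
  Splits f = Σ[ u ∈ Carrier ] Σ[ as ∈ List Carrier ]
               (f ≈ₚ constₚ u *ₚ prodₚ (map (λ a → Xₚ -ₚ constₚ a) as))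

{-# OPTIONS --safe #-}
-- Write r = 2m + 1 and C = γ^(2m), so f(z) = (z^(2m) + 1)^(m+1) - e z^(rm) with e γ^(rm) = (C + 1)^(m+1), and f
-- has degree 2m(m+1) = (r + 1) m.  If s^m = 1 then f(s z) = f(z), so the roots of f come in orbits under the m
-- elements s of F_r with s^m = 1; it suffices to find r + 1 roots whose 2m-th powers are pairwise distinct.
-- The first is γ itself.  Since Tr γ = 0, additive Hilbert 90 gives b with b^r - b = γ, and every w = b + t with
-- t in F_r satisfies w^r = w + γ, hence w^(r²) = w + γ (C + 1).  Clearing denominators shows that γ / w^(r+1) is a
-- root, and w · (w^(r+1))^(2m) = w + γ (C + 1) shows that these r roots have distinct 2m-th powers, all different
-- from C, as long as C ≠ -1.  If C = -1 then e = 0 and f = (z^(2m) + 1)^(m+1), where z^(2m) + 1 has the 2m roots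
-- γ t, t ∈ F_r^×.
module Submission where

open import Defs
open import Algebra.Bundles using (CommutativeRing)
import Algebra.Properties.CommutativeMonoid.Sum as CommutativeMonoidSum
import Algebra.Solver.Ring
open import Algebra.Solver.Ring.AlmostCommutativeRing using (_-Raw-AlmostCommutative⟶_; fromCommutativeRing)
open import Data.Empty using (⊥-elim)
open import Data.Fin as Fin using (Fin; toℕ; inject₁; fromℕ)
import Data.Fin.Properties as Fin
open import Data.Fin.Permutation using (Permutation; permutation; _⟨$⟩ʳ_)
open import Data.Integer as ℤ using (ℤ; +_; -[1+_]; _⊖_)
import Data.Integer.Properties as ℤ
open import Data.List using (List; []; _∷_; map; length; take; filter; concat; concatMap; replicate; tabulate; _++_)
import Data.List.Properties as List
open import Data.List.Relation.Unary.All as All using (All; []; _∷_)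
import Data.List.Relation.Unary.All.Properties as All
open import Data.List.Relation.Unary.AllPairs as AllPairs using (AllPairs; []; _∷_)
import Data.List.Relation.Unary.AllPairs.Properties as AllPairs
open import Data.Maybe using (Maybe; just; nothing)
open import Data.Nat using (ℕ; _∸_; _^_; _/_; _≤_) renaming (_+_ to _+ℕ_; _*_ to _*ℕ_)
open import Data.Nat as ℕ using (zero; suc; z≤n; s≤s; _!)
import Data.Nat.Properties as ℕ
open import Data.Nat.Combinatorics using (_C_; nCn≡1; nCk≡n!/k![n-k]!; k![n∸k]!∣n!)
open import Data.Nat.Divisibility using (_∣_; divides; ∣1⇒≡1; ∣⇒≤; m∣m*n; m%n≡0⇒n∣m)
open import Data.Nat.DivMod using (_%_; m/n*n≡m; m≡m%n+[m/n]*n; m%n<n; m*n/n≡m)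
open import Data.Nat.Primality using (Prime; prime[2]; euclidsLemma; prime⇒irreducible; prime⇒nonZero; prime⇒nonTrivial)
open import Data.Nat.Tactic.RingSolver using (solve-∀)
open import Data.Product using (∃; _×_; _,_; proj₁; proj₂)
open import Data.Sign as Sign using (Sign)
open import Data.Sum using (inj₁; inj₂)
open import Function using (_∘_)
open import Function.Bundles using (Inverse)
open import Level using (_⊔_)
open import Relation.Binary.PropositionalEquality using (_≡_; _≢_; setoid)
import Relation.Binary.PropositionalEquality as ≡
open import Relation.Nullary using (¬_; Dec; yes; no; contradiction)
open import Relation.Nullary.Decidable using (¬?; decidable-stable)
open import Relation.Unary using (Pred; Decidable; U; _⊆_; _∩_)
open import Relation.Unary.Properties using (∁?)

-- The ring solver needs coefficients whose equality it can decide; ℤ maps into every commutative ring.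
module ℤCoefficientSolver {c ℓ} (R : CommutativeRing c ℓ) where
  open CommutativeRing R
  open import Algebra.Properties.Ring ring using (-0#≈0#; -‿involutive; -‿+-comm; -1*x≈-x; xyx⁻¹≈y)
  open import Algebra.Properties.Semiring.Mult semiring using (×-homo-+; ×1-homo-*) renaming (_×_ to _×ₙ_)
  open import Relation.Binary.Reasoning.Setoid (CommutativeRing.setoid R)

  ⟦_⟧ℤ : ℤ → Carrier
  ⟦ + n ⟧ℤ    = n ×ₙ 1#
  ⟦ -[1+ n ] ⟧ℤ = - (suc n ×ₙ 1#)

  ⟦⟧ℤ-homo-‿ : ∀ i → ⟦ ℤ.- i ⟧ℤ ≈ - ⟦ i ⟧ℤ
  ⟦⟧ℤ-homo-‿ (+ zero)  = sym -0#≈0#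
  ⟦⟧ℤ-homo-‿ (+ suc n) = refl
  ⟦⟧ℤ-homo-‿ -[1+ n ]  = sym (-‿involutive _)

  ⟦⟧ℤ-homo-⊖ : ∀ m n → ⟦ m ⊖ n ⟧ℤ ≈ m ×ₙ 1# - n ×ₙ 1#
  ⟦⟧ℤ-homo-⊖ m       zero    = sym (trans (+-congˡ -0#≈0#) (+-identityʳ _))
  ⟦⟧ℤ-homo-⊖ zero    (suc n) = sym (+-identityˡ _)
  ⟦⟧ℤ-homo-⊖ (suc m) (suc n) = begin
    ⟦ suc m ⊖ suc n ⟧ℤ     ≡⟨ ≡.cong ⟦_⟧ℤ (ℤ.[1+m]⊖[1+n]≡m⊖n m n) ⟩
    ⟦ m ⊖ n ⟧ℤ             ≈⟨ ⟦⟧ℤ-homo-⊖ m n ⟩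
    a - b                  ≈⟨ +-congʳ (xyx⁻¹≈y 1# a) ⟨
    1# + a - 1# - b        ≈⟨ +-assoc _ _ _ ⟩
    (1# + a) + (- 1# - b)  ≈⟨ +-congˡ (-‿+-comm 1# b) ⟩
    (1# + a) - (1# + b)    ∎
    where
    a b : Carrier
    a = m ×ₙ 1#
    b = n ×ₙ 1#

  ⟦⟧ℤ-homo-+ : ∀ i j → ⟦ i ℤ.+ j ⟧ℤ ≈ ⟦ i ⟧ℤ + ⟦ j ⟧ℤ
  ⟦⟧ℤ-homo-+ (+ m)    (+ n)    = ×-homo-+ 1# m n
  ⟦⟧ℤ-homo-+ (+ m)    -[1+ n ] = ⟦⟧ℤ-homo-⊖ m (suc n)
  ⟦⟧ℤ-homo-+ -[1+ m ] (+ n)    = trans (⟦⟧ℤ-homo-⊖ n (suc m)) (+-comm _ _)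
  ⟦⟧ℤ-homo-+ -[1+ m ] -[1+ n ] = begin
    - (suc (suc (m ℕ.+ n)) ×ₙ 1#)      ≡⟨ ≡.cong (λ k → - (suc k ×ₙ 1#)) (ℕ.+-suc m n) ⟨
    - ((suc m ℕ.+ suc n) ×ₙ 1#)        ≈⟨ -‿cong (×-homo-+ 1# (suc m) (suc n)) ⟩
    - (suc m ×ₙ 1# + suc n ×ₙ 1#)      ≈⟨ -‿+-comm _ _ ⟨
    - (suc m ×ₙ 1#) + - (suc n ×ₙ 1#)  ∎

  ⟦_⟧± : Sign → Carrier
  ⟦ Sign.+ ⟧± = 1#
  ⟦ Sign.- ⟧± = - 1#

  ⟦⟧±-homo-* : ∀ s t → ⟦ s Sign.* t ⟧± ≈ ⟦ s ⟧± * ⟦ t ⟧±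
  ⟦⟧±-homo-* Sign.+ t      = sym (*-identityˡ _)
  ⟦⟧±-homo-* Sign.- Sign.+ = sym (*-identityʳ _)
  ⟦⟧±-homo-* Sign.- Sign.- = sym (trans (-1*x≈-x _) (-‿involutive _))

  ⟦◃⟧ℤ : ∀ s n → ⟦ s ℤ.◃ n ⟧ℤ ≈ ⟦ s ⟧± * (n ×ₙ 1#)
  ⟦◃⟧ℤ s      zero    = sym (zeroʳ _)
  ⟦◃⟧ℤ Sign.+ (suc n) = sym (*-identityˡ _)
  ⟦◃⟧ℤ Sign.- (suc n) = sym (-1*x≈-x _)

  ⟦⟧ℤ-sign-abs : ∀ i → ⟦ i ⟧ℤ ≈ ⟦ ℤ.sign i ⟧± * (ℤ.∣ i ∣ ×ₙ 1#)
  ⟦⟧ℤ-sign-abs i = trans (reflexive (≡.cong ⟦_⟧ℤ (≡.sym (ℤ.◃-inverse i)))) (⟦◃⟧ℤ (ℤ.sign i) ℤ.∣ i ∣)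

  ⟦⟧ℤ-homo-* : ∀ i j → ⟦ i ℤ.* j ⟧ℤ ≈ ⟦ i ⟧ℤ * ⟦ j ⟧ℤ
  ⟦⟧ℤ-homo-* i j = begin
    ⟦ i ℤ.* j ⟧ℤ       ≈⟨ ⟦◃⟧ℤ (ℤ.sign i Sign.* ℤ.sign j) (ℤ.∣ i ∣ ℕ.* ℤ.∣ j ∣) ⟩
    ⟦ ℤ.sign i Sign.* ℤ.sign j ⟧± * ((ℤ.∣ i ∣ ℕ.* ℤ.∣ j ∣) ×ₙ 1#)
                       ≈⟨ *-cong (⟦⟧±-homo-* (ℤ.sign i) (ℤ.sign j)) (×1-homo-* ℤ.∣ i ∣ ℤ.∣ j ∣) ⟩
    (s * t) * (a * b)  ≈⟨ *-assoc s t _ ⟩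
    s * (t * (a * b))  ≈⟨ *-congˡ (trans (sym (*-assoc t a b)) (trans (*-congʳ (*-comm t a)) (*-assoc a t b))) ⟩
    s * (a * (t * b))  ≈⟨ *-assoc s a _ ⟨
    (s * a) * (t * b)  ≈⟨ *-cong (⟦⟧ℤ-sign-abs i) (⟦⟧ℤ-sign-abs j) ⟨
    ⟦ i ⟧ℤ * ⟦ j ⟧ℤ    ∎
    where
    s t a b : Carrier
    s = ⟦ ℤ.sign i ⟧±
    t = ⟦ ℤ.sign j ⟧±
    a = ℤ.∣ i ∣ ×ₙ 1#
    b = ℤ.∣ j ∣ ×ₙ 1#

  ℤ⟶R : ℤ.+-*-rawRing -Raw-AlmostCommutative⟶ fromCommutativeRing R
  ℤ⟶R = record
    { ⟦_⟧ = ⟦_⟧ℤ ; +-homo = ⟦⟧ℤ-homo-+ ; *-homo = ⟦⟧ℤ-homo-* ; -‿homo = ⟦⟧ℤ-homo-‿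
    ; 0-homo = refl ; 1-homo = +-identityʳ 1# }

  _coeff≟_ : ∀ i j → Maybe (⟦ i ⟧ℤ ≈ ⟦ j ⟧ℤ)
  i coeff≟ j with i ℤ.≟ j
  ... | yes ≡.refl = just refl
  ... | no _       = nothing

  open Algebra.Solver.Ring ℤ.+-*-rawRing (fromCommutativeRing R) ℤ⟶R _coeff≟_ public

module FieldLemmas {c ℓ} (F : Field c ℓ) where
  open FieldPoly F public hiding (zero)
  open ℤCoefficientSolver commutativeRing public using (solve; _:=_; _:+_; _:-_; _:*_; :-_)
  open import Algebra.Properties.Ring ring public
    using (-0#≈0#; -‿distribˡ-*; +-identityʳ-unique; +-cancelˡ; [y-z]x≈yx-zx)
    renaming (x∙y⁻¹≈ε⇒x≈y to x-y≈0⇒x≈y; x≈y⇒x∙y⁻¹≈ε to x≈y⇒x-y≈0)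
  open import Algebra.Properties.Semiring.Exp semiring
    using (^-congˡ; ^-homo-*; ^-assocʳ) renaming (_^_ to _^ˢ_)
  open import Algebra.Properties.CommutativeSemiring.Exp commutativeSemiring
    using (^-distrib-*)
  open import Relation.Binary.Reasoning.Setoid (Field.setoid F) public

  ^ᶠ≡^ : ∀ x n → x ^ᶠ n ≡ x ^ˢ n
  ^ᶠ≡^ x zero    = ≡.refl
  ^ᶠ≡^ x (suc n) = ≡.cong (x *_) (^ᶠ≡^ x n)

  ^ᶠ-congˡ : ∀ {x y} n → x ≈ y → x ^ᶠ n ≈ y ^ᶠ n
  ^ᶠ-congˡ {x} {y} n x≈y rewrite ^ᶠ≡^ x n | ^ᶠ≡^ y n = ^-congˡ n x≈y

  ^ᶠ-congʳ : ∀ x {m n} → m ≡ n → x ^ᶠ m ≈ x ^ᶠ n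
  ^ᶠ-congʳ x ≡.refl = refl

  ^ᶠ-homo-* : ∀ x m n → x ^ᶠ (m ℕ.+ n) ≈ x ^ᶠ m * x ^ᶠ n
  ^ᶠ-homo-* x m n rewrite ^ᶠ≡^ x (m ℕ.+ n) | ^ᶠ≡^ x m | ^ᶠ≡^ x n = ^-homo-* x m n

  ^ᶠ-assocʳ : ∀ x m n → (x ^ᶠ m) ^ᶠ n ≈ x ^ᶠ (m ℕ.* n)
  ^ᶠ-assocʳ x m n rewrite ^ᶠ≡^ (x ^ᶠ m) n | ^ᶠ≡^ x m | ^ᶠ≡^ x (m ℕ.* n) = ^-assocʳ x m n

  ^ᶠ-distrib-* : ∀ x y n → (x * y) ^ᶠ n ≈ x ^ᶠ n * y ^ᶠ n
  ^ᶠ-distrib-* x y n rewrite ^ᶠ≡^ (x * y) n | ^ᶠ≡^ x n | ^ᶠ≡^ y n = ^-distrib-* x y n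

  1^ᶠ : ∀ n → 1# ^ᶠ n ≈ 1#
  1^ᶠ zero    = refl
  1^ᶠ (suc n) = trans (*-identityˡ _) (1^ᶠ n)

  0^ᶠ : ∀ {n} → .{{ℕ.NonZero n}} → 0# ^ᶠ n ≈ 0#
  0^ᶠ {suc n} = zeroˡ _

  x^ᶠ1 : ∀ x → x ^ᶠ 1 ≈ x
  x^ᶠ1 = *-identityʳ

  x^ᶠm≈1⇒x^ᶠ[m*n]≈1 : ∀ {x} m n → x ^ᶠ m ≈ 1# → x ^ᶠ (m ℕ.* n) ≈ 1#
  x^ᶠm≈1⇒x^ᶠ[m*n]≈1 {x} m n x^m≈1 = trans (sym (^ᶠ-assocʳ x m n)) (trans (^ᶠ-congˡ n x^m≈1) (1^ᶠ n))

  inv : ∀ x → x ≉ 0# → Carrier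
  inv x x≉0 = proj₁ (inverse x x≉0)

  x*inv≈1 : ∀ {x} (x≉0 : x ≉ 0#) → x * inv x x≉0 ≈ 1#
  x*inv≈1 {x} x≉0 = proj₂ (inverse x x≉0)

  *-cancelˡ : ∀ {x y z} → x ≉ 0# → x * y ≈ x * z → y ≈ z
  *-cancelˡ {x} {y} {z} x≉0 xy≈xz = begin
    y                    ≈⟨ inv-cancels y ⟨
    inv x x≉0 * (x * y)  ≈⟨ *-congˡ xy≈xz ⟩
    inv x x≉0 * (x * z)  ≈⟨ inv-cancels z ⟩
    z                    ∎
    where
    inv-cancels : ∀ u → inv x x≉0 * (x * u) ≈ u
    inv-cancels u = begin
      inv x x≉0 * (x * u)  ≈⟨ *-assoc _ _ _ ⟨
      (inv x x≉0 * x) * u  ≈⟨ *-congʳ (trans (*-comm _ _) (x*inv≈1 x≉0)) ⟩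
      1# * u               ≈⟨ *-identityˡ u ⟩
      u                    ∎

  inv-^ᶠ-fixed : ∀ {x} (x≉0 : x ≉ 0#) n → x ^ᶠ n ≈ x → inv x x≉0 ^ᶠ n ≈ inv x x≉0
  inv-^ᶠ-fixed {x} x≉0 n x^n≈x = *-cancelˡ x≉0 (begin
    x * inv x x≉0 ^ᶠ n       ≈⟨ *-congʳ x^n≈x ⟨
    x ^ᶠ n * inv x x≉0 ^ᶠ n  ≈⟨ ^ᶠ-distrib-* x _ n ⟨
    (x * inv x x≉0) ^ᶠ n     ≈⟨ trans (^ᶠ-congˡ n (x*inv≈1 x≉0)) (1^ᶠ n) ⟩
    1#                       ≈⟨ x*inv≈1 x≉0 ⟨
    x * inv x x≉0            ∎)

  *-cancelʳ : ∀ {x y z} → x ≉ 0# → y * x ≈ z * x → y ≈ z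
  *-cancelʳ x≉0 yx≈zx = *-cancelˡ x≉0 (trans (*-comm _ _) (trans yx≈zx (*-comm _ _)))

  x*y≈0⇒y≈0 : ∀ {x y} → x ≉ 0# → x * y ≈ 0# → y ≈ 0#
  x*y≈0⇒y≈0 {x} x≉0 xy≈0 = *-cancelˡ x≉0 (trans xy≈0 (sym (zeroʳ x)))

  *-≉0 : ∀ {x y} → x ≉ 0# → y ≉ 0# → x * y ≉ 0#
  *-≉0 x≉0 y≉0 xy≈0 = y≉0 (x*y≈0⇒y≈0 x≉0 xy≈0)

  ^ᶠ-≉0 : ∀ {x} n → x ≉ 0# → x ^ᶠ n ≉ 0#
  ^ᶠ-≉0 zero    x≉0 = 1≉0
  ^ᶠ-≉0 (suc n) x≉0 = *-≉0 x≉0 (^ᶠ-≉0 n x≉0)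

  x≉y⇒x-y≉0 : ∀ {x y} → x ≉ y → x - y ≉ 0#
  x≉y⇒x-y≉0 x≉y x-y≈0 = x≉y (x-y≈0⇒x≈y _ _ x-y≈0)

  sumᶠ-cong : ∀ n {f g : ℕ → Carrier} → (∀ i → f i ≈ g i) → sumᶠ n f ≈ sumᶠ n g
  sumᶠ-cong zero    f≈g = refl
  sumᶠ-cong (suc n) f≈g = +-cong (sumᶠ-cong n f≈g) (f≈g n)

  sumᶠ-distrib-+ : ∀ n (f g : ℕ → Carrier) → sumᶠ n (λ i → f i + g i) ≈ sumᶠ n f + sumᶠ n g
  sumᶠ-distrib-+ zero    f g = sym (+-identityˡ _)
  sumᶠ-distrib-+ (suc n) f g = begin
    sumᶠ n (λ i → f i + g i) + (f n + g n)  ≈⟨ +-congʳ (sumᶠ-distrib-+ n f g) ⟩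
    (sumᶠ n f + sumᶠ n g) + (f n + g n)     ≈⟨ solve 4 (λ a b c d → (a :+ b) :+ (c :+ d) := (a :+ c) :+ (b :+ d)) refl _ _ _ _ ⟩
    (sumᶠ n f + f n) + (sumᶠ n g + g n)     ∎

  *-distribˡ-sumᶠ : ∀ n a (f : ℕ → Carrier) → a * sumᶠ n f ≈ sumᶠ n (λ i → a * f i)
  *-distribˡ-sumᶠ zero    a f = zeroʳ a
  *-distribˡ-sumᶠ (suc n) a f = trans (distribˡ _ _ _) (+-congʳ (*-distribˡ-sumᶠ n a f))

  sumᶠ-suc : ∀ n (f : ℕ → Carrier) → sumᶠ (suc n) f ≈ f 0 + sumᶠ n (λ i → f (suc i))
  sumᶠ-suc zero    f = +-comm _ _
  sumᶠ-suc (suc n) f = trans (+-congʳ (sumᶠ-suc n f)) (+-assoc _ _ _)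

  sumᶠ-rotate : ∀ n (f : ℕ → Carrier) → f 0 ≈ f n → sumᶠ n (λ i → f (suc i)) ≈ sumᶠ n f
  sumᶠ-rotate n f f0≈fn = begin
    sumᶠ n (λ i → f (suc i))                ≈⟨ solve 2 (λ a b → b := (a :+ b) :- a) refl (f 0) _ ⟩
    (f 0 + sumᶠ n (λ i → f (suc i))) - f 0  ≈⟨ +-cong (sym (sumᶠ-suc n f)) (-‿cong f0≈fn) ⟩
    (sumᶠ n f + f n) - f n                  ≈⟨ solve 2 (λ a b → (a :+ b) :- b := a) refl (sumᶠ n f) (f n) ⟩
    sumᶠ n f                                ∎

  sumᶠ-telescope : ∀ n (u : ℕ → Carrier) → sumᶠ n (λ i → u (suc i) - u i) ≈ u n - u 0
  sumᶠ-telescope zero    u = sym (-‿inverseʳ _)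
  sumᶠ-telescope (suc n) u = trans (+-congʳ (sumᶠ-telescope n u))
    (solve 3 (λ a b c → (b :- a) :+ (c :- b) := c :- a) refl (u 0) (u n) (u (suc n)))

module PolynomialLemmas {c ℓ} (F : Field c ℓ) where
  open FieldLemmas F public
  open import Data.List.Relation.Unary.Unique.Setoid (Field.setoid F) public
    using () renaming (Unique to Distinct)

  eval : Poly → Carrier → Carrier
  eval []      x = 0#
  eval (a ∷ p) x = a + x * eval p x

  IsRoot : Poly → Carrier → Set ℓ
  IsRoot p x = eval p x ≈ 0#

  linear : Carrier → Poly
  linear a = Xₚ -ₚ constₚ a

  DegreeBelow : ℕ → Poly → Set ℓ
  DegreeBelow d p = ∀ i → d ℕ.≤ i → coeff p i ≈ 0#

  record Monic (d : ℕ) (p : Poly) : Set ℓ where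
    constructor monic
    field
      degree  : DegreeBelow (suc d) p
      leading : coeff p d ≈ 1#

  sumₚ : ℕ → (ℕ → Poly) → Poly
  sumₚ zero    f = []
  sumₚ (suc n) f = sumₚ n f +ₚ f n

  eval-+ₚ : ∀ p q x → eval (p +ₚ q) x ≈ eval p x + eval q x
  eval-+ₚ []      q       x = sym (+-identityˡ _)
  eval-+ₚ (a ∷ p) []      x = sym (+-identityʳ _)
  eval-+ₚ (a ∷ p) (b ∷ q) x = begin
    (a + b) + x * eval (p +ₚ q) x            ≈⟨ +-congˡ (*-congˡ (eval-+ₚ p q x)) ⟩
    (a + b) + x * (eval p x + eval q x)      ≈⟨ solve 5 (λ a b x u v → (a :+ b) :+ x :* (u :+ v) := (a :+ x :* u) :+ (b :+ x :* v)) refl a b x _ _ ⟩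
    (a + x * eval p x) + (b + x * eval q x)  ∎

  eval-scale : ∀ a q x → eval (map (a *_) q) x ≈ a * eval q x
  eval-scale a []      x = sym (zeroʳ a)
  eval-scale a (b ∷ q) x = begin
    a * b + x * eval (map (a *_) q) x  ≈⟨ +-congˡ (*-congˡ (eval-scale a q x)) ⟩
    a * b + x * (a * eval q x)         ≈⟨ solve 4 (λ a b x u → a :* b :+ x :* (a :* u) := a :* (b :+ x :* u)) refl a b x _ ⟩
    a * (b + x * eval q x)             ∎

  eval-*ₚ : ∀ p q x → eval (p *ₚ q) x ≈ eval p x * eval q x
  eval-*ₚ []      q x = sym (zeroˡ _)
  eval-*ₚ (a ∷ p) q x = begin
    eval (map (a *_) q +ₚ (0# ∷ (p *ₚ q))) x            ≈⟨ eval-+ₚ (map (a *_) q) _ x ⟩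
    eval (map (a *_) q) x + (0# + x * eval (p *ₚ q) x)  ≈⟨ +-cong (eval-scale a q x) (trans (+-identityˡ _) (*-congˡ (eval-*ₚ p q x))) ⟩
    a * eval q x + x * (eval p x * eval q x)            ≈⟨ solve 4 (λ a x u v → a :* v :+ x :* (u :* v) := (a :+ x :* u) :* v) refl a x _ _ ⟩
    (a + x * eval p x) * eval q x                       ∎

  eval-negate : ∀ p x → eval (-ₚ p) x ≈ - eval p x
  eval-negate []      x = sym -0#≈0#
  eval-negate (a ∷ p) x = begin
    - a + x * eval (-ₚ p) x  ≈⟨ +-congˡ (*-congˡ (eval-negate p x)) ⟩
    - a + x * - eval p x     ≈⟨ solve 3 (λ a x u → :- a :+ x :* (:- u) := :- (a :+ x :* u)) refl a x _ ⟩
    - (a + x * eval p x)     ∎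

  eval-sub : ∀ p q x → eval (p -ₚ q) x ≈ eval p x - eval q x
  eval-sub p q x = trans (eval-+ₚ p (-ₚ q) x) (+-congˡ (eval-negate q x))

  eval-const : ∀ a x → eval (constₚ a) x ≈ a
  eval-const a x = trans (+-congˡ (zeroʳ x)) (+-identityʳ a)

  eval-X : ∀ x → eval Xₚ x ≈ x
  eval-X x = trans (+-identityˡ _) (trans (*-congˡ (eval-const 1# x)) (*-identityʳ x))

  eval-^ₚ : ∀ p n x → eval (p ^ₚ n) x ≈ eval p x ^ᶠ n
  eval-^ₚ p zero    x = eval-const 1# x
  eval-^ₚ p (suc n) x = trans (eval-*ₚ p (p ^ₚ n) x) (*-congˡ (eval-^ₚ p n x))

  eval-X^ : ∀ n x → eval (Xₚ ^ₚ n) x ≈ x ^ᶠ n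
  eval-X^ n x = trans (eval-^ₚ Xₚ n x) (^ᶠ-congˡ n (eval-X x))

  eval-linear : ∀ a x → eval (linear a) x ≈ x - a
  eval-linear a x = trans (eval-sub Xₚ (constₚ a) x) (+-cong (eval-X x) (-‿cong (eval-const a x)))

  eval-sumₚ : ∀ n f x → eval (sumₚ n f) x ≈ sumᶠ n (λ i → eval (f i) x)
  eval-sumₚ zero    f x = refl
  eval-sumₚ (suc n) f x = trans (eval-+ₚ (sumₚ n f) (f n) x) (+-congʳ (eval-sumₚ n f x))

  coeff-+ₚ : ∀ p q i → coeff (p +ₚ q) i ≈ coeff p i + coeff q i
  coeff-+ₚ []      q       i       = sym (+-identityˡ _)
  coeff-+ₚ (a ∷ p) []      zero    = sym (+-identityʳ _)
  coeff-+ₚ (a ∷ p) []      (suc i) = sym (+-identityʳ _)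
  coeff-+ₚ (a ∷ p) (b ∷ q) zero    = refl
  coeff-+ₚ (a ∷ p) (b ∷ q) (suc i) = coeff-+ₚ p q i

  coeff-scale : ∀ a q i → coeff (map (a *_) q) i ≈ a * coeff q i
  coeff-scale a []      i       = sym (zeroʳ a)
  coeff-scale a (b ∷ q) zero    = refl
  coeff-scale a (b ∷ q) (suc i) = coeff-scale a q i

  coeff-negate : ∀ p i → coeff (-ₚ p) i ≈ - coeff p i
  coeff-negate []      i       = sym -0#≈0#
  coeff-negate (a ∷ p) zero    = refl
  coeff-negate (a ∷ p) (suc i) = coeff-negate p i

  coeff-sub : ∀ p q i → coeff (p -ₚ q) i ≈ coeff p i - coeff q i
  coeff-sub p q i = trans (coeff-+ₚ p (-ₚ q) i) (+-congˡ (coeff-negate q i))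

  coeff-*ₚ-∷ : ∀ a p q i → coeff ((a ∷ p) *ₚ q) i ≈ a * coeff q i + coeff (0# ∷ (p *ₚ q)) i
  coeff-*ₚ-∷ a p q i = trans (coeff-+ₚ (map (a *_) q) _ i) (+-congʳ (coeff-scale a q i))

  eval-zero : ∀ p → DegreeBelow 0 p → ∀ x → eval p x ≈ 0#
  eval-zero []      p≈0 x = refl
  eval-zero (a ∷ p) p≈0 x = begin
    a + x * eval p x  ≈⟨ +-cong (p≈0 0 z≤n) (*-congˡ (eval-zero p (λ i _ → p≈0 (suc i) z≤n) x)) ⟩
    0# + x * 0#       ≈⟨ trans (+-identityˡ _) (zeroʳ x) ⟩
    0#                ∎

  eval-≈ₚ : ∀ p q → p ≈ₚ q → ∀ x → eval p x ≈ eval q x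
  eval-≈ₚ p q p≈q x = x-y≈0⇒x≈y _ _ (trans (sym (eval-sub p q x))
    (eval-zero (p -ₚ q) (λ i _ → trans (coeff-sub p q i) (x≈y⇒x-y≈0 (p≈q i))) x))

  degree-≤ : ∀ {d e} p → d ℕ.≤ e → DegreeBelow d p → DegreeBelow e p
  degree-≤ p d≤e deg i e≤i = deg i (ℕ.≤-trans d≤e e≤i)

  degree-+ₚ : ∀ {d} p q → DegreeBelow d p → DegreeBelow d q → DegreeBelow d (p +ₚ q)
  degree-+ₚ p q degp degq i d≤i =
    trans (coeff-+ₚ p q i) (trans (+-cong (degp i d≤i) (degq i d≤i)) (+-identityˡ 0#))

  degree-sub : ∀ {d} p q → DegreeBelow d p → DegreeBelow d q → DegreeBelow d (p -ₚ q)
  degree-sub p q degp degq i d≤i =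
    trans (coeff-sub p q i) (trans (+-cong (degp i d≤i) (-‿cong (degq i d≤i))) (-‿inverseʳ 0#))

  degree-const : ∀ a → DegreeBelow 1 (constₚ a)
  degree-const a (suc i) _ = refl

  zero-*ₚ : ∀ p q → DegreeBelow 0 p → DegreeBelow 0 (p *ₚ q)
  zero-*ₚ []      q p≈0 i _ = refl
  zero-*ₚ (a ∷ p) q p≈0 i _ = begin
    coeff ((a ∷ p) *ₚ q) i                   ≈⟨ coeff-*ₚ-∷ a p q i ⟩
    a * coeff q i + coeff (0# ∷ (p *ₚ q)) i  ≈⟨ +-cong (trans (*-congʳ (p≈0 0 z≤n)) (zeroˡ _)) (tail≈0 i) ⟩
    0# + 0#                                  ≈⟨ +-identityˡ 0# ⟩
    0#                                       ∎
    where
    tail≈0 : ∀ i → coeff (0# ∷ (p *ₚ q)) i ≈ 0#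
    tail≈0 zero    = refl
    tail≈0 (suc i) = zero-*ₚ p q (λ j _ → p≈0 (suc j) z≤n) i z≤n

  degree-*ₚ : ∀ {d e} p q → DegreeBelow d p → DegreeBelow (suc e) q → DegreeBelow (d ℕ.+ e) (p *ₚ q)
  degree-*ₚ          []      q degp degq i _ = refl
  degree-*ₚ {zero}   p       q degp degq i _ = zero-*ₚ p q degp i z≤n
  degree-*ₚ {suc d} {e} (a ∷ p) q degp degq i d+e<i = begin
    coeff ((a ∷ p) *ₚ q) i                   ≈⟨ coeff-*ₚ-∷ a p q i ⟩
    a * coeff q i + coeff (0# ∷ (p *ₚ q)) i  ≈⟨ +-cong (trans (*-congˡ (degq i e<i)) (zeroʳ a)) (tail≈0 i d+e<i) ⟩
    0# + 0#                                  ≈⟨ +-identityˡ 0# ⟩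
    0#                                       ∎
    where
    e<i : suc e ℕ.≤ i
    e<i = ℕ.≤-trans (s≤s (ℕ.m≤n+m e d)) d+e<i
    tail≈0 : DegreeBelow (suc (d ℕ.+ e)) (0# ∷ (p *ₚ q))
    tail≈0 (suc i) (s≤s d+e≤i) = degree-*ₚ p q (λ j d≤j → degp (suc j) (s≤s d≤j)) degq i d+e≤i

  coeff-*ₚ-leading : ∀ {d e} p q → DegreeBelow (suc d) p → DegreeBelow (suc e) q →
                     coeff (p *ₚ q) (d ℕ.+ e) ≈ coeff p d * coeff q e
  coeff-*ₚ-leading []      q degp degq = sym (zeroˡ _)
  coeff-*ₚ-leading {zero} {e} (a ∷ p) q degp degq = begin
    coeff ((a ∷ p) *ₚ q) e                   ≈⟨ coeff-*ₚ-∷ a p q e ⟩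
    a * coeff q e + coeff (0# ∷ (p *ₚ q)) e  ≈⟨ +-congˡ (tail≈0 e) ⟩
    a * coeff q e + 0#                       ≈⟨ +-identityʳ _ ⟩
    a * coeff q e                            ∎
    where
    tail≈0 : ∀ i → coeff (0# ∷ (p *ₚ q)) i ≈ 0#
    tail≈0 zero    = refl
    tail≈0 (suc i) = zero-*ₚ p q (λ j _ → degp (suc j) (s≤s z≤n)) i z≤n
  coeff-*ₚ-leading {suc d} {e} (a ∷ p) q degp degq = begin
    coeff ((a ∷ p) *ₚ q) (suc (d ℕ.+ e))                    ≈⟨ coeff-*ₚ-∷ a p q (suc (d ℕ.+ e)) ⟩
    a * coeff q (suc (d ℕ.+ e)) + coeff (p *ₚ q) (d ℕ.+ e)  ≈⟨ +-cong (trans (*-congˡ (degq _ (s≤s (ℕ.m≤n+m e d)))) (zeroʳ a))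
                                                                       (coeff-*ₚ-leading p q (λ j d<j → degp (suc j) (s≤s d<j)) degq) ⟩
    0# + coeff p d * coeff q e                              ≈⟨ +-identityˡ _ ⟩
    coeff p d * coeff q e                                   ∎

  monic-*ₚ : ∀ {d e p q} → Monic d p → Monic e q → Monic (d ℕ.+ e) (p *ₚ q)
  monic-*ₚ {d} {e} {p} {q} (monic degp lcp) (monic degq lcq) = monic
    (degree-*ₚ p q degp degq)
    (trans (coeff-*ₚ-leading p q degp degq) (trans (*-cong lcp lcq) (*-identityˡ 1#)))

  monic-1 : Monic 0 1ₚ
  monic-1 = monic (degree-const 1#) refl

  monic-X : Monic 1 Xₚ
  monic-X = monic (λ { (suc (suc i)) _ → refl ; (suc zero) (s≤s ()) }) refl

  monic-^ₚ : ∀ {d p} n → Monic d p → Monic (n ℕ.* d) (p ^ₚ n)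
  monic-^ₚ zero    p-monic = monic-1
  monic-^ₚ (suc n) p-monic = monic-*ₚ p-monic (monic-^ₚ n p-monic)

  monic-X^ : ∀ n → Monic n (Xₚ ^ₚ n)
  monic-X^ n = ≡.subst (λ d → Monic d (Xₚ ^ₚ n)) (ℕ.*-identityʳ n) (monic-^ₚ n monic-X)

  monic-+ₚ-lowerʳ : ∀ {d p} q → Monic d p → DegreeBelow d q → Monic d (p +ₚ q)
  monic-+ₚ-lowerʳ {d} {p} q (monic degp lcp) degq = monic
    (degree-+ₚ p q degp (degree-≤ q (ℕ.n≤1+n d) degq))
    (trans (coeff-+ₚ p q d) (trans (+-cong lcp (degq d ℕ.≤-refl)) (+-identityʳ 1#)))

  monic-+ₚ-lowerˡ : ∀ {d q} p → DegreeBelow d p → Monic d q → Monic d (p +ₚ q)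
  monic-+ₚ-lowerˡ {d} {q} p degp (monic degq lcq) = monic
    (degree-+ₚ p q (degree-≤ p (ℕ.n≤1+n d) degp) degq)
    (trans (coeff-+ₚ p q d) (trans (+-cong (degp d ℕ.≤-refl) lcq) (+-identityˡ 1#)))

  monic-sub-lower : ∀ {d p} q → Monic d p → DegreeBelow d q → Monic d (p -ₚ q)
  monic-sub-lower {d} {p} q (monic degp lcp) degq = monic
    (degree-sub p q degp (degree-≤ q (ℕ.n≤1+n d) degq))
    (trans (coeff-sub p q d) (trans (+-cong lcp (-‿cong (degq d ℕ.≤-refl))) (trans (+-congˡ -0#≈0#) (+-identityʳ 1#))))

  monic-linear : ∀ a → Monic 1 (linear a)
  monic-linear a = monic-sub-lower (constₚ a) monic-X (degree-const a)

  monic-prod-linear : ∀ as → Monic (length as) (prodₚ (map linear as))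
  monic-prod-linear []       = monic-1
  monic-prod-linear (a ∷ as) = monic-*ₚ (monic-linear a) (monic-prod-linear as)

  monic-sumₚ : ∀ {d : ℕ → ℕ} {f : ℕ → Poly} → (∀ i → Monic (d i) (f i)) → (∀ i → d i ℕ.< d (suc i)) →
               ∀ n → Monic (d n) (sumₚ (suc n) f)
  monic-sumₚ f-monic d-increasing zero    = f-monic 0
  monic-sumₚ f-monic d-increasing (suc n) = monic-+ₚ-lowerˡ _
    (λ i d[1+n]≤i → Monic.degree (monic-sumₚ f-monic d-increasing n) i (ℕ.≤-trans (d-increasing n) d[1+n]≤i))
    (f-monic (suc n))

  X^_+1 : ℕ → Poly
  X^ n +1 = Xₚ ^ₚ n +ₚ 1ₚ

  eval-X^+1 : ∀ n x → eval (X^ n +1) x ≈ x ^ᶠ n + 1#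
  eval-X^+1 n x = trans (eval-+ₚ (Xₚ ^ₚ n) 1ₚ x) (+-cong (eval-X^ n x) (eval-const 1# x))

  monic-X^+1 : ∀ n → .{{ℕ.NonZero n}} → Monic n (X^ n +1)
  monic-X^+1 n = monic-+ₚ-lowerʳ 1ₚ (monic-X^ n) (degree-≤ 1ₚ (ℕ.>-nonZero⁻¹ n) (degree-const 1#))

  monic-sub-monic : ∀ {d} p q → Monic d p → Monic d q → DegreeBelow d (p -ₚ q)
  monic-sub-monic {d} p q (monic degp lcp) (monic degq lcq) i d≤i with ℕ.m≤n⇒m<n∨m≡n d≤i
  ... | inj₁ d<i    = degree-sub p q degp degq i d<i
  ... | inj₂ ≡.refl = trans (coeff-sub p q d) (trans (+-cong lcp (-‿cong lcq)) (-‿inverseʳ 1#))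

  ≈ₚ-from-sub : ∀ p q → DegreeBelow 0 (p -ₚ q) → p ≈ₚ q
  ≈ₚ-from-sub p q p-q≈0 i = x-y≈0⇒x≈y _ _ (trans (sym (coeff-sub p q i)) (p-q≈0 i z≤n))

  quot : Carrier → Poly → Poly
  quot a []       = []
  quot a (c ∷ cs) = eval cs a ∷ quot a cs

  eval-quot : ∀ a p x → eval p x ≈ (x - a) * eval (quot a p) x + eval p a
  eval-quot a []       x = sym (trans (+-identityʳ _) (zeroʳ _))
  eval-quot a (c ∷ cs) x = begin
    c + x * eval cs x                                     ≈⟨ +-congˡ (*-congˡ (eval-quot a cs x)) ⟩
    c + x * ((x - a) * eval (quot a cs) x + eval cs a)    ≈⟨ solve 5 (λ a x c q v → c :+ x :* ((x :- a) :* q :+ v) := (x :- a) :* (v :+ x :* q) :+ (c :+ a :* v))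
                                                                  refl a x c (eval (quot a cs) x) (eval cs a) ⟩
    (x - a) * eval (quot a (c ∷ cs)) x + eval (c ∷ cs) a  ∎

  coeff-quot : ∀ a p i → coeff p i ≈ coeff (eval p a ∷ quot a p) i - a * coeff (quot a p) i
  coeff-quot a []       zero    = sym (trans (+-congˡ (trans (-‿cong (zeroʳ a)) -0#≈0#)) (+-identityʳ 0#))
  coeff-quot a []       (suc i) = sym (trans (+-congˡ (trans (-‿cong (zeroʳ a)) -0#≈0#)) (+-identityʳ 0#))
  coeff-quot a (c ∷ cs) zero    = solve 3 (λ c a v → c := (c :+ a :* v) :- a :* v) refl c a (eval cs a)
  coeff-quot a (c ∷ cs) (suc i) = coeff-quot a cs i

  degree-quot : ∀ {d} a p → DegreeBelow (suc d) p → DegreeBelow d (quot a p)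
  degree-quot a []       deg i _ = refl
  degree-quot {zero} a (c ∷ cs) deg zero    _ = eval-zero cs (λ j _ → deg (suc j) (s≤s z≤n)) a
  degree-quot {zero} a (c ∷ cs) deg (suc i) _ = degree-quot a cs (λ j _ → deg (suc j) (s≤s z≤n)) i z≤n
  degree-quot {suc d} a (c ∷ cs) deg (suc i) (s≤s d≤i) = degree-quot a cs (λ j d<j → deg (suc j) (s≤s d<j)) i d≤i

  root-of-quot : ∀ {a x} p → IsRoot p a → a ≉ x → IsRoot p x → IsRoot (quot a p) x
  root-of-quot {a} {x} p pa≈0 a≉x px≈0 = x*y≈0⇒y≈0 (x≉y⇒x-y≉0 (a≉x ∘ sym)) (begin
    (x - a) * eval (quot a p) x             ≈⟨ +-identityʳ _ ⟨
    (x - a) * eval (quot a p) x + 0#        ≈⟨ +-congˡ pa≈0 ⟨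
    (x - a) * eval (quot a p) x + eval p a  ≈⟨ eval-quot a p x ⟨
    eval p x                                ≈⟨ px≈0 ⟩
    0#                                      ∎)

  roots⇒zero : ∀ p rs → DegreeBelow (length rs) p → Distinct rs → All (IsRoot p) rs → DegreeBelow 0 p
  roots⇒zero p []       deg _                    _               = deg
  roots⇒zero p (a ∷ rs) deg (a≉rs ∷ rs-distinct) (pa≈0 ∷ p-roots) i _ = begin
    coeff p i                               ≈⟨ coeff-quot a p i ⟩
    coeff (eval p a ∷ q) i - a * coeff q i  ≈⟨ +-cong (q′≈0 i) (-‿cong (trans (*-congˡ (q≈0 i z≤n)) (zeroʳ a))) ⟩
    0# - 0#                                 ≈⟨ -‿inverseʳ 0# ⟩
    0#                                      ∎
    where
    q : Poly
    q = quot a p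
    q≈0 : DegreeBelow 0 q
    q≈0 = roots⇒zero q rs (degree-quot a p deg) rs-distinct
      (All.zipWith (λ (a≉x , px≈0) → root-of-quot p pa≈0 a≉x px≈0) (a≉rs , p-roots))
    q′≈0 : ∀ i → coeff (eval p a ∷ q) i ≈ 0#
    q′≈0 zero    = pa≈0
    q′≈0 (suc i) = q≈0 i z≤n

  monic-roots-length≤ : ∀ {d p rs} → Monic d p → Distinct rs → All (IsRoot p) rs → length rs ℕ.≤ d
  monic-roots-length≤ {d} {p} {rs} (monic deg lc) distinct roots with length rs ℕ.≤? d
  ... | yes ok  = ok
  ... | no  d<∣rs∣ = contradiction (trans (sym lc) p≈0) 1≉0
    where
    rs′ : List Carrier
    rs′ = take (suc d) rs
    ∣rs′∣≡1+d : length rs′ ≡ suc d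
    ∣rs′∣≡1+d = ≡.trans (List.length-take (suc d) rs) (ℕ.m≤n⇒m⊓n≡m (ℕ.≰⇒> d<∣rs∣))
    p≈0 : coeff p d ≈ 0#
    p≈0 = roots⇒zero p rs′ (≡.subst (λ k → DegreeBelow k p) (≡.sym ∣rs′∣≡1+d) deg)
            (AllPairs.take⁺ (suc d) distinct) (All.take⁺ (suc d) roots) d z≤n

  eval-prod-linear-∷ : ∀ a rs x → eval (prodₚ (map linear (a ∷ rs))) x ≈ (x - a) * eval (prodₚ (map linear rs)) x
  eval-prod-linear-∷ a rs x = trans (eval-*ₚ (linear a) (prodₚ (map linear rs)) x) (*-congʳ (eval-linear a x))

  prod-linear-roots : ∀ rs → All (IsRoot (prodₚ (map linear rs))) rs
  prod-linear-roots []       = []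
  prod-linear-roots (a ∷ rs) =
    trans (eval-prod-linear-∷ a rs a) (trans (*-congʳ (-‿inverseʳ a)) (zeroˡ _)) ∷
    All.map (λ {x} root → trans (eval-prod-linear-∷ a rs x) (trans (*-congˡ root) (zeroʳ _))) (prod-linear-roots rs)

  eval-prod-linear-++ : ∀ xs ys x → eval (prodₚ (map linear (xs ++ ys))) x ≈ eval (prodₚ (map linear xs)) x * eval (prodₚ (map linear ys)) x
  eval-prod-linear-++ []       ys x = sym (trans (*-congʳ (eval-const 1# x)) (*-identityˡ _))
  eval-prod-linear-++ (a ∷ xs) ys x = begin
    eval (prodₚ (map linear (a ∷ xs ++ ys))) x                                   ≈⟨ eval-prod-linear-∷ a (xs ++ ys) x ⟩
    (x - a) * eval (prodₚ (map linear (xs ++ ys))) x                             ≈⟨ *-congˡ (eval-prod-linear-++ xs ys x) ⟩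
    (x - a) * (eval (prodₚ (map linear xs)) x * eval (prodₚ (map linear ys)) x)  ≈⟨ *-assoc _ _ _ ⟨
    ((x - a) * eval (prodₚ (map linear xs)) x) * eval (prodₚ (map linear ys)) x  ≈⟨ *-congʳ (eval-prod-linear-∷ a xs x) ⟨
    eval (prodₚ (map linear (a ∷ xs))) x * eval (prodₚ (map linear ys)) x        ∎

  monic-roots⇒≈ₚ : ∀ {d} f rs → Monic d f → length rs ≡ d → Distinct rs → All (IsRoot f) rs → f ≈ₚ 1ₚ *ₚ prodₚ (map linear rs)
  monic-roots⇒≈ₚ {d} f rs f-monic ∣rs∣≡d distinct f-roots =
    ≈ₚ-from-sub f g (roots⇒zero (f -ₚ g) rs (≡.subst (λ k → DegreeBelow k (f -ₚ g)) (≡.sym ∣rs∣≡d) (monic-sub-monic f g f-monic g-monic))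
                                 distinct (All.zipWith f-g-root (f-roots , prod-linear-roots rs)))
    where
    g : Poly
    g = 1ₚ *ₚ prodₚ (map linear rs)
    g-monic : Monic d g
    g-monic = ≡.subst (λ k → Monic k g) ∣rs∣≡d (monic-*ₚ monic-1 (monic-prod-linear rs))
    f-g-root : ∀ {x} → IsRoot f x × IsRoot (prodₚ (map linear rs)) x → IsRoot (f -ₚ g) x
    f-g-root {x} (fx≈0 , px≈0) = begin
      eval (f -ₚ g) x      ≈⟨ eval-sub f g x ⟩
      eval f x - eval g x  ≈⟨ +-cong fx≈0 (-‿cong (trans (eval-*ₚ 1ₚ (prodₚ (map linear rs)) x) (trans (*-congˡ px≈0) (zeroʳ _)))) ⟩
      0# - 0#              ≈⟨ -‿inverseʳ 0# ⟩
      0#                   ∎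

  ≈ₚ-from-eval : ∀ {d} p q xs → length xs ≡ d → DegreeBelow d p → DegreeBelow d q → Distinct xs →
                 All (λ x → eval p x ≈ eval q x) xs → p ≈ₚ q
  ≈ₚ-from-eval p q xs ≡.refl degp degq distinct agree = ≈ₚ-from-sub p q
    (roots⇒zero (p -ₚ q) xs (degree-sub p q degp degq) distinct
       (All.map (λ {x} px≈qx → trans (eval-sub p q x) (x≈y⇒x-y≈0 px≈qx)) agree))

AllPairs-restrict : ∀ {a p r s} {A : Set a} {P : Pred A p} {R : A → A → Set r} {S : A → A → Set s} {xs} →
                    All P xs → AllPairs.AllPairs R xs → (∀ {x y} → P x → P y → R x y → S x y) → AllPairs.AllPairs S xs
AllPairs-restrict []         []         PR⇒S = []
AllPairs-restrict (px ∷ pxs) (rx ∷ rxs) PR⇒S =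
  All.zipWith (λ (py , rxy) → PR⇒S px py rxy) (pxs , rx) ∷ AllPairs-restrict pxs rxs PR⇒S

module Counting {c ℓ} (F : Field c ℓ) where
  open PolynomialLemmas F

  record AtLeast {p} (k : ℕ) (P : Pred Carrier p) : Set (c ⊔ ℓ ⊔ p) where
    constructor atLeast
    field
      witnesses          : List Carrier
      length-witnesses   : length witnesses ≡ k
      witnesses-distinct : Distinct witnesses
      witnesses-satisfy  : All P witnesses

  module _ {p} {P : Pred Carrier p} where

    atLeast-take : ∀ k {xs} → k ℕ.≤ length xs → Distinct xs → All P xs → AtLeast k P
    atLeast-take k {xs} k≤∣xs∣ distinct sat = atLeast (take k xs)
      (≡.trans (List.length-take k xs) (ℕ.m≤n⇒m⊓n≡m k≤∣xs∣)) (AllPairs.take⁺ k distinct) (All.take⁺ k sat)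

    atLeast-≤ : ∀ {j k} → j ℕ.≤ k → AtLeast k P → AtLeast j P
    atLeast-≤ {j} j≤k (atLeast xs ≡.refl distinct sat) = atLeast-take j j≤k distinct sat

    atLeast-map : ∀ {k q} {Q : Pred Carrier q} → P ⊆ Q → AtLeast k P → AtLeast k Q
    atLeast-map P⊆Q (atLeast xs ∣xs∣ distinct sat) = atLeast xs ∣xs∣ distinct (All.map P⊆Q sat)

    atLeast-witness : ∀ {k} → AtLeast (suc k) P → ∃ P
    atLeast-witness (atLeast (x ∷ _) _ _ (px ∷ _)) = x , px

  length-filter+filter∁ : ∀ {q} {Q : Pred Carrier q} (Q? : Decidable Q) xs →
                          length (filter Q? xs) ℕ.+ length (filter (∁? Q?) xs) ≡ length xs
  length-filter+filter∁ Q? []       = ≡.refl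
  length-filter+filter∁ Q? (x ∷ xs) with Q? x
  ... | yes _ = ≡.cong suc (length-filter+filter∁ Q? xs)
  ... | no  _ = ≡.trans (ℕ.+-suc _ _) (≡.cong suc (length-filter+filter∁ Q? xs))

  -- The elements of a family that fail Q are distinct roots of g, hence at most deg g of them.
  sieve : ∀ {p q} {P : Pred Carrier p} {Q : Pred Carrier q} {k d N g} →
          AtLeast N P → Decidable Q → Monic d g → (∀ {x} → P x → ¬ Q x → IsRoot g x) →
          k ℕ.+ d ℕ.≤ N → AtLeast k (P ∩ Q)
  sieve {k = k} {d} (atLeast xs ≡.refl distinct sat) Q? g-monic g-roots k+d≤N =
    atLeast-take k k≤∣ys∣ (AllPairs.filter⁺ Q? distinct) (All.zip (All.filter⁺ Q? sat , All.all-filter Q? xs))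
    where
    ys zs : List Carrier
    ys = filter Q? xs
    zs = filter (∁? Q?) xs
    ∣zs∣≤d : length zs ℕ.≤ d
    ∣zs∣≤d = monic-roots-length≤ g-monic (AllPairs.filter⁺ (∁? Q?) distinct)
               (All.zipWith (λ (px , ¬qx) → g-roots px ¬qx) (All.filter⁺ (∁? Q?) sat , All.all-filter (∁? Q?) xs))
    k≤∣ys∣ : k ℕ.≤ length ys
    k≤∣ys∣ = ℕ.+-cancelʳ-≤ d k (length ys) (ℕ.≤-trans k+d≤N
               (≡.subst (ℕ._≤ length ys ℕ.+ d) (length-filter+filter∁ Q? xs) (ℕ.+-monoʳ-≤ (length ys) ∣zs∣≤d)))

module Orbits {c ℓ} (F : Field c ℓ) where
  open PolynomialLemmas F

  orbits : List Carrier → List Carrier → List Carrier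
  orbits zs ss = concatMap (λ z → map (_* z) ss) zs

  length-orbits : ∀ zs ss → length (orbits zs ss) ≡ length zs ℕ.* length ss
  length-orbits []       ss = ≡.refl
  length-orbits (z ∷ zs) ss = ≡.trans (List.length-++ (map (_* z) ss))
    (≡.cong₂ ℕ._+_ (List.length-map (_* z) ss) (length-orbits zs ss))

  All-orbits : ∀ {p q r} {P : Pred Carrier p} {Q : Pred Carrier q} {R : Pred Carrier r} {zs ss} →
               All Q zs → All R ss → (∀ {z s} → Q z → R s → P (s * z)) → All P (orbits zs ss)
  All-orbits Qzs Rss QR⇒P = All.concat⁺ (All.map⁺ (All.map (λ Qz → All.map⁺ (All.map (QR⇒P Qz) Rss)) Qzs))

  orbits-distinct : ∀ j {zs ss} → AllPairs.AllPairs (λ z z′ → z ^ᶠ j ≉ z′ ^ᶠ j) zs → All (_≉ 0#) zs →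
                    Distinct ss → All (λ s → s ^ᶠ j ≈ 1#) ss → Distinct (orbits zs ss)
  orbits-distinct j {zs} {ss} zs-apart zs≉0 ss-distinct ss^j≈1 =
    AllPairs.concat⁺ (All.map⁺ (All.map orbit-distinct zs≉0)) (AllPairs.map⁺ (AllPairs.map orbits-apart zs-apart))
    where
    ^j-invariant : ∀ {s} z → s ^ᶠ j ≈ 1# → (s * z) ^ᶠ j ≈ z ^ᶠ j
    ^j-invariant {s} z s^j≈1 = trans (^ᶠ-distrib-* s z j) (trans (*-congʳ s^j≈1) (*-identityˡ _))
    orbit-distinct : ∀ {z} → z ≉ 0# → Distinct (map (_* z) ss)
    orbit-distinct z≉0 = AllPairs.map⁺ (AllPairs.map (λ s≉s′ → s≉s′ ∘ *-cancelʳ z≉0) ss-distinct)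
    orbits-apart : ∀ {z z′} → z ^ᶠ j ≉ z′ ^ᶠ j → All (λ u → All (u ≉_) (map (_* z′) ss)) (map (_* z) ss)
    orbits-apart {z} {z′} z≉z′ = All.map⁺ (All.map (λ s^j≈1 → All.map⁺ (All.map (λ s′^j≈1 u≈u′ →
      z≉z′ (trans (sym (^j-invariant z s^j≈1)) (trans (^ᶠ-congˡ j u≈u′) (^j-invariant z′ s′^j≈1)))) ss^j≈1)) ss^j≈1)

n∣n! : ∀ n → .{{ℕ.NonZero n}} → n ∣ n !
n∣n! (suc n) = m∣m*n (n !)

p∤m! : ∀ {p} → Prime p → ∀ m → m ℕ.< p → ¬ p ∣ m !
p∤m! p-prime zero    _   p∣1 = ℕ.<⇒≢ (ℕ.nonTrivial⇒n>1 _ {{prime⇒nonTrivial p-prime}}) (≡.sym (∣1⇒≡1 p∣1))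
p∤m! p-prime (suc m) m<p p∣m! with euclidsLemma (suc m) (m !) p-prime p∣m!
... | inj₁ p∣1+m = ℕ.<⇒≱ m<p (∣⇒≤ p∣1+m)
... | inj₂ p∣m!  = p∤m! p-prime m (ℕ.<-trans (ℕ.n<1+n m) m<p) p∣m!

-- p divides p! = (p C k) * k! * (p - k)! but neither factorial.
p∣pCk : ∀ {p k} → Prime p → 0 ℕ.< k → k ℕ.< p → p ∣ p C k
p∣pCk {p} {k} p-prime 0<k k<p with euclidsLemma (p C k) (k ! ℕ.* (p ℕ.∸ k) !) p-prime p∣pCk*k![p-k]!
  where
  instance
    k![p-k]!≢0 : ℕ.NonZero (k ! ℕ.* (p ℕ.∸ k) !)
    k![p-k]!≢0 = k ℕ.!* (p ℕ.∸ k) !≢0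
  p∣pCk*k![p-k]! : p ∣ (p C k) ℕ.* (k ! ℕ.* (p ℕ.∸ k) !)
  p∣pCk*k![p-k]! = ≡.subst (p ∣_)
    (≡.sym (≡.trans (≡.cong (ℕ._* (k ! ℕ.* (p ℕ.∸ k) !)) (nCk≡n!/k![n-k]! (ℕ.<⇒≤ k<p))) (m/n*n≡m (k![n∸k]!∣n! (ℕ.<⇒≤ k<p)))))
    (n∣n! p {{prime⇒nonZero p-prime}})
... | inj₁ p∣pCk = p∣pCk
... | inj₂ p∣k!*[p-k]! with euclidsLemma (k !) ((p ℕ.∸ k) !) p-prime p∣k!*[p-k]!
...   | inj₁ p∣k!     = contradiction p∣k! (p∤m! p-prime k k<p)
...   | inj₂ p∣[p-k]! = contradiction p∣[p-k]! (p∤m! p-prime (p ℕ.∸ k) (ℕ.∸-monoʳ-< 0<k (ℕ.<⇒≤ k<p)))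

module AdditivePowers {c ℓ} (F : Field c ℓ) where
  open FieldLemmas F
  open import Algebra.Properties.Semiring.Mult semiring using (×-homo-1; ×-congˡ; ×-congʳ; ×-assoc-*; ×1-homo-*) renaming (_×_ to _×ₙ_)
  open import Algebra.Properties.Semiring.Exp semiring using () renaming (_^_ to _^ˢ_)
  open import Algebra.Properties.Monoid.Sum +-monoid using (sum; sum-cong-≋; sum-replicate-zero; sum-init-last)
  open import Algebra.Properties.CommutativeSemiring.Binomial commutativeSemiring using (theorem)

  Additive : ℕ → Set (c ⊔ ℓ)
  Additive q = ∀ x y → (x + y) ^ᶠ q ≈ x ^ᶠ q + y ^ᶠ q

  additive-* : ∀ {a b} → Additive a → Additive b → Additive (a ℕ.* b)
  additive-* {a} {b} additive-a additive-b x y = begin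
    (x + y) ^ᶠ (a ℕ.* b)             ≈⟨ ^ᶠ-assocʳ (x + y) a b ⟨
    ((x + y) ^ᶠ a) ^ᶠ b              ≈⟨ ^ᶠ-congˡ b (additive-a x y) ⟩
    (x ^ᶠ a + y ^ᶠ a) ^ᶠ b           ≈⟨ additive-b _ _ ⟩
    (x ^ᶠ a) ^ᶠ b + (y ^ᶠ a) ^ᶠ b    ≈⟨ +-cong (^ᶠ-assocʳ x a b) (^ᶠ-assocʳ y a b) ⟩
    x ^ᶠ (a ℕ.* b) + y ^ᶠ (a ℕ.* b)  ∎

  additive-^ : ∀ {a} → Additive a → ∀ k → Additive (a ℕ.^ k)
  additive-^ additive-a zero    x y = trans (x^ᶠ1 _) (+-cong (sym (x^ᶠ1 x)) (sym (x^ᶠ1 y)))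
  additive-^ {a} additive-a (suc k) = additive-* {a} {a ℕ.^ k} additive-a (additive-^ additive-a k)

  ∣⇒×≈0 : ∀ {p m} → p ×ₙ 1# ≈ 0# → p ∣ m → ∀ x → m ×ₙ x ≈ 0#
  ∣⇒×≈0 {p} p≈0 (divides q ≡.refl) x = begin
    (q ℕ.* p) ×ₙ x         ≈⟨ trans (×-assoc-* (q ℕ.* p) 1# x) (×-congʳ (q ℕ.* p) (*-identityˡ x)) ⟨
    ((q ℕ.* p) ×ₙ 1#) * x  ≈⟨ *-congʳ (trans (×1-homo-* q p) (*-congˡ p≈0)) ⟩
    ((q ×ₙ 1#) * 0#) * x   ≈⟨ trans (*-congʳ (zeroʳ _)) (zeroˡ x) ⟩
    0#                     ∎

  -- Binomial theorem: all inner coefficients p C k are divisible by p.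
  frobenius : ∀ {p} → Prime p → p ×ₙ 1# ≈ 0# → Additive p
  frobenius {zero}    p-prime = ⊥-elim (ℕ.≢-nonZero⁻¹ 0 {{prime⇒nonZero p-prime}} ≡.refl)
  frobenius {p@(suc p′)} p-prime p≈0 x y = begin
    (x + y) ^ᶠ p                                      ≡⟨ ^ᶠ≡^ (x + y) p ⟩
    (x + y) ^ˢ p                                      ≈⟨ theorem p x y ⟩
    term Fin.zero + sum (λ i → term (Fin.suc i))      ≈⟨ +-congˡ (sum-init-last (λ i → term (Fin.suc i))) ⟩
    term Fin.zero + (sum (λ j → term (Fin.suc (inject₁ j))) + term (Fin.suc (fromℕ p′)))
                                                      ≈⟨ +-congˡ (+-congʳ (trans (sum-cong-≋ inner≈0) (sum-replicate-zero p′))) ⟩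
    term Fin.zero + (0# + term (Fin.suc (fromℕ p′)))  ≈⟨ +-cong first (trans (+-identityˡ _) last) ⟩
    y ^ᶠ p + x ^ᶠ p                                   ≈⟨ +-comm _ _ ⟩
    x ^ᶠ p + y ^ᶠ p                                   ∎
    where
    term : Fin (suc p) → Carrier
    term k = (p C toℕ k) ×ₙ ((x ^ˢ toℕ k) * (y ^ˢ (p ℕ.∸ toℕ k)))
    first : term Fin.zero ≈ y ^ᶠ p
    first = trans (×-homo-1 _) (trans (*-identityˡ _) (reflexive (≡.sym (^ᶠ≡^ y p))))
    last : term (Fin.suc (fromℕ p′)) ≈ x ^ᶠ p
    last = begin
      term (Fin.suc (fromℕ p′))                   ≡⟨ ≡.cong (λ k → (p C suc k) ×ₙ ((x ^ˢ suc k) * (y ^ˢ (p′ ℕ.∸ k)))) (Fin.toℕ-fromℕ p′) ⟩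
      (p C p) ×ₙ ((x ^ˢ p) * (y ^ˢ (p′ ℕ.∸ p′)))  ≈⟨ trans (×-congˡ (nCn≡1 p)) (×-homo-1 _) ⟩
      (x ^ˢ p) * (y ^ˢ (p′ ℕ.∸ p′))               ≡⟨ ≡.cong (λ k → (x ^ˢ p) * (y ^ˢ k)) (ℕ.n∸n≡0 p′) ⟩
      (x ^ˢ p) * 1#                               ≈⟨ *-identityʳ _ ⟩
      x ^ˢ p                                      ≡⟨ ^ᶠ≡^ x p ⟨
      x ^ᶠ p                                      ∎
    inner≈0 : ∀ j → term (Fin.suc (inject₁ j)) ≈ 0#
    inner≈0 j = ∣⇒×≈0 p≈0 (p∣pCk p-prime (s≤s z≤n)
      (s≤s (≡.subst (ℕ._< p′) (≡.sym (Fin.toℕ-inject₁ j)) (Fin.toℕ<n j)))) _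

  module _ {q} .{{_ : ℕ.NonZero q}} (additive : Additive q) where

    additive-sub : ∀ x y → (x - y) ^ᶠ q ≈ x ^ᶠ q - y ^ᶠ q
    additive-sub x y = begin
      (x - y) ^ᶠ q                      ≈⟨ solve 2 (λ a b → a := (a :+ b) :- b) refl _ (y ^ᶠ q) ⟩
      ((x - y) ^ᶠ q + y ^ᶠ q) - y ^ᶠ q  ≈⟨ +-congʳ (additive (x - y) y) ⟨
      ((x - y) + y) ^ᶠ q - y ^ᶠ q       ≈⟨ +-congʳ (^ᶠ-congˡ q (solve 2 (λ x y → (x :- y) :+ y := x) refl x y)) ⟩
      x ^ᶠ q - y ^ᶠ q                   ∎

    additive-‿ : ∀ x → (- x) ^ᶠ q ≈ - (x ^ᶠ q)
    additive-‿ x = begin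
      (- x) ^ᶠ q        ≈⟨ ^ᶠ-congˡ q (+-identityˡ _) ⟨
      (0# - x) ^ᶠ q     ≈⟨ additive-sub 0# x ⟩
      0# ^ᶠ q - x ^ᶠ q  ≈⟨ trans (+-congʳ 0^ᶠ) (+-identityˡ _) ⟩
      - (x ^ᶠ q)        ∎

    additive-sumᶠ : ∀ n f → sumᶠ n f ^ᶠ q ≈ sumᶠ n (λ i → f i ^ᶠ q)
    additive-sumᶠ zero    f = 0^ᶠ
    additive-sumᶠ (suc n) f = trans (additive _ _) (+-congʳ (additive-sumᶠ n f))

  module Hilbert90 (r n : ℕ) .{{_ : ℕ.NonZero r}} (additive : Additive r) (periodic : ∀ x → x ^ᶠ (r ^ n) ≈ x) where

    frobenius-iterate : ∀ x i → (x ^ᶠ (r ℕ.^ i)) ^ᶠ r ≈ x ^ᶠ (r ℕ.^ suc i)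
    frobenius-iterate x i = trans (^ᶠ-assocʳ x (r ℕ.^ i) r) (^ᶠ-congʳ x (ℕ.*-comm (r ℕ.^ i) r))

    Tr-rotate : ∀ x → sumᶠ n (λ i → x ^ᶠ (r ℕ.^ suc i)) ≈ Tr r n x
    Tr-rotate x = sumᶠ-rotate n (λ i → x ^ᶠ (r ℕ.^ i)) (trans (x^ᶠ1 x) (sym (periodic x)))

    Tr-fixed : ∀ x → Tr r n x ^ᶠ r ≈ Tr r n x
    Tr-fixed x = trans (additive-sumᶠ additive n _) (trans (sumᶠ-cong n (frobenius-iterate x)) (Tr-rotate x))

    partialTrace : Carrier → ℕ → Carrier
    partialTrace c i = sumᶠ i (λ j → c ^ᶠ (r ℕ.^ j))

    partialTrace-frobenius : ∀ c i → partialTrace c i ^ᶠ r ≈ partialTrace c (suc i) - c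
    partialTrace-frobenius c i = begin
      partialTrace c i ^ᶠ r                                  ≈⟨ additive-sumᶠ additive i _ ⟩
      sumᶠ i (λ j → (c ^ᶠ (r ℕ.^ j)) ^ᶠ r)                   ≈⟨ sumᶠ-cong i (frobenius-iterate c) ⟩
      sumᶠ i (λ j → c ^ᶠ (r ℕ.^ suc j))                      ≈⟨ solve 2 (λ a b → b := (a :+ b) :- a) refl (c ^ᶠ 1) _ ⟩
      (c ^ᶠ 1 + sumᶠ i (λ j → c ^ᶠ (r ℕ.^ suc j))) - c ^ᶠ 1  ≈⟨ +-cong (sym (sumᶠ-suc i _)) (-‿cong (x^ᶠ1 c)) ⟩
      partialTrace c (suc i) - c                             ∎

    resolvent : Carrier → Carrier → Carrier
    resolvent c θ = sumᶠ n (λ i → partialTrace c i * θ ^ᶠ (r ℕ.^ i))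

    -- Frobenius shifts the index of each term; the shifted sum closes up because S₀ = 0 and Sₙ = Tr c = 0.
    resolvent-frobenius : ∀ {c} → Tr r n c ≈ 0# → ∀ θ → resolvent c θ ^ᶠ r ≈ resolvent c θ - c * Tr r n θ
    resolvent-frobenius {c} Trc≈0 θ = begin
      resolvent c θ ^ᶠ r                                        ≈⟨ additive-sumᶠ additive n _ ⟩
      sumᶠ n (λ i → (S i * θ′ i) ^ᶠ r)                          ≈⟨ sumᶠ-cong n (λ i → trans (^ᶠ-distrib-* (S i) (θ′ i) r)
                                                                      (*-cong (partialTrace-frobenius c i) (frobenius-iterate θ i))) ⟩
      sumᶠ n (λ i → (S (suc i) - c) * θ′ (suc i))               ≈⟨ sumᶠ-cong n (λ i → [y-z]x≈yx-zx (θ′ (suc i)) (S (suc i)) c) ⟩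
      sumᶠ n (λ i → S (suc i) * θ′ (suc i) - c * θ′ (suc i))    ≈⟨ sumᶠ-cong n (λ i → +-congˡ (-‿distribˡ-* c (θ′ (suc i)))) ⟩
      sumᶠ n (λ i → S (suc i) * θ′ (suc i) + - c * θ′ (suc i))  ≈⟨ sumᶠ-distrib-+ n _ _ ⟩
      sumᶠ n (λ i → S (suc i) * θ′ (suc i)) + sumᶠ n (λ i → - c * θ′ (suc i))
                                                                ≈⟨ +-congʳ (sumᶠ-rotate n (λ i → S i * θ′ i) S₀θ≈Sₙθ′ₙ) ⟩
      resolvent c θ + sumᶠ n (λ i → - c * θ′ (suc i))           ≈⟨ +-congˡ (*-distribˡ-sumᶠ n (- c) _) ⟨
      resolvent c θ + - c * sumᶠ n (λ i → θ′ (suc i))           ≈⟨ +-congˡ (*-congˡ (Tr-rotate θ)) ⟩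
      resolvent c θ + - c * Tr r n θ                            ≈⟨ +-congˡ (-‿distribˡ-* c (Tr r n θ)) ⟨
      resolvent c θ - c * Tr r n θ                              ∎
      where
      S θ′ : ℕ → Carrier
      S = partialTrace c
      θ′ i = θ ^ᶠ (r ℕ.^ i)
      S₀θ≈Sₙθ′ₙ : S 0 * θ′ 0 ≈ S n * θ′ n
      S₀θ≈Sₙθ′ₙ = trans (zeroˡ _) (sym (trans (*-congʳ Trc≈0) (zeroˡ _)))

    hilbert90 : ∀ {θ c} → Tr r n θ ≉ 0# → Tr r n c ≈ 0# → ∃ λ b → b ^ᶠ r - b ≈ c
    hilbert90 {θ} {c} τ≉0 Trc≈0 = - (B * τ⁻¹) , (begin
      (- (B * τ⁻¹)) ^ᶠ r - - (B * τ⁻¹)     ≈⟨ +-congʳ (trans (additive-‿ additive _) (-‿cong (^ᶠ-distrib-* B τ⁻¹ r))) ⟩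
      - (B ^ᶠ r * τ⁻¹ ^ᶠ r) - - (B * τ⁻¹)  ≈⟨ +-congʳ (-‿cong (*-cong (resolvent-frobenius Trc≈0 θ) (inv-^ᶠ-fixed τ≉0 r (Tr-fixed θ)))) ⟩
      - ((B - c * τ) * τ⁻¹) - - (B * τ⁻¹)  ≈⟨ solve 4 (λ B c t i → :- ((B :- c :* t) :* i) :- (:- (B :* i)) := c :* (t :* i)) refl B c τ τ⁻¹ ⟩
      c * (τ * τ⁻¹)                        ≈⟨ trans (*-congˡ (x*inv≈1 τ≉0)) (*-identityʳ c) ⟩
      c                                    ∎)
      where
      τ B τ⁻¹ : Carrier
      τ = Tr r n θ
      B = resolvent c θ
      τ⁻¹ = inv τ τ≉0

module FiniteField {c ℓ} (F : Field c ℓ) {q} (enum : Inverse (≡.setoid (Fin q)) (Field.setoid F)) where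
  open PolynomialLemmas F
  open Counting F
  open Inverse enum using (to; from; to-cong; from-cong; strictlyInverseˡ; strictlyInverseʳ)
  open import Algebra.Properties.Semiring.Mult semiring using () renaming (_×_ to _×ₙ_)
  module ∑ = CommutativeMonoidSum +-commutativeMonoid
  module ∏ = CommutativeMonoidSum *-commutativeMonoid

  infix 4 _≟_
  _≟_ : ∀ x y → Dec (x ≈ y)
  x ≟ y with from x Fin.≟ from y
  ... | yes fx≡fy = yes (trans (sym (strictlyInverseˡ x)) (trans (to-cong fx≡fy) (strictlyInverseˡ y)))
  ... | no  fx≢fy = no (fx≢fy ∘ from-cong)

  all-elements : AtLeast q U
  all-elements = atLeast (tabulate to) (List.length-tabulate to)
    (AllPairs.tabulate⁺ (λ i≢j toi≈toj → i≢j (≡.trans (≡.sym (strictlyInverseʳ _)) (≡.trans (from-cong toi≈toj) (strictlyInverseʳ _)))))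
    (All.tabulate _)

  -- Total inverse, with the junk value 0 ⁻¹ = 0.
  _⁻¹ : Carrier → Carrier
  x ⁻¹ with x ≟ 0#
  ... | yes _   = 0#
  ... | no  x≉0 = inv x x≉0

  x*x⁻¹≈1 : ∀ {x} → x ≉ 0# → x * x ⁻¹ ≈ 1#
  x*x⁻¹≈1 {x} x≉0 with x ≟ 0#
  ... | yes x≈0 = contradiction x≈0 x≉0
  ... | no  x≉0 = x*inv≈1 x≉0

  permutationOf : (h h′ : Carrier → Carrier) → (∀ {x y} → x ≈ y → h x ≈ h y) → (∀ {x y} → x ≈ y → h′ x ≈ h′ y) →
                  (∀ x → h (h′ x) ≈ x) → (∀ x → h′ (h x) ≈ x) → Permutation q q
  permutationOf h h′ h-cong h′-cong hh′ h′h = permutation (from ∘ h ∘ to) (from ∘ h′ ∘ to)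
    (λ i → ≡.trans (from-cong (trans (h-cong (strictlyInverseˡ _)) (hh′ (to i)))) (strictlyInverseʳ i))
    (λ i → ≡.trans (from-cong (trans (h′-cong (strictlyInverseˡ _)) (h′h (to i)))) (strictlyInverseʳ i))

  -- Translation by 1 permutes the field: Σ x = Σ (x + 1) = Σ x + q ×ₙ 1.
  q×1≈0 : q ×ₙ 1# ≈ 0#
  q×1≈0 = +-identityʳ-unique Σ (q ×ₙ 1#) (begin
      Σ + q ×ₙ 1#                  ≈⟨ +-congˡ (∑.sum-replicate q) ⟨
      Σ + ∑.sum {q} (λ _ → 1#)     ≈⟨ ∑.∑-distrib-+ to (λ _ → 1#) ⟨
      ∑.sum {q} (λ i → to i + 1#)  ≈⟨ ∑.sum-cong-≋ {q} (λ i → strictlyInverseˡ _) ⟨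
      ∑.sum {q} (to ∘ (π ⟨$⟩ʳ_))   ≈⟨ ∑.sum-permute to π ⟨
      Σ                            ∎)
    where
    Σ : Carrier
    Σ = ∑.sum to
    π : Permutation q q
    π = permutationOf (_+ 1#) (_- 1#) +-congʳ +-congʳ
          (λ x → solve 2 (λ x o → (x :- o) :+ o := x) refl x 1#) (λ x → solve 2 (λ x o → (x :+ o) :- o := x) refl x 1#)

  ∏-≉0 : ∀ {n} (t : Fin n → Carrier) → (∀ i → t i ≉ 0#) → ∏.sum t ≉ 0#
  ∏-≉0 {zero}  t t≉0 = 1≉0
  ∏-≉0 {suc n} t t≉0 = *-≉0 (t≉0 Fin.zero) (∏-≉0 (t ∘ Fin.suc) (t≉0 ∘ Fin.suc))

  ∏-single : ∀ {n} (t : Fin n → Carrier) i → (∀ j → j ≢ i → t j ≈ 1#) → ∏.sum t ≈ t i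
  ∏-single {suc n} t i t≈1 = begin
    ∏.sum t                          ≈⟨ ∏.sum-remove {i = i} t ⟩
    t i * ∏.sum (t ∘ Fin.punchIn i)  ≈⟨ *-congˡ (trans (∏.sum-cong-≋ {n} (λ j → t≈1 _ (Fin.punchInᵢ≢i i j))) (∏.sum-replicate-zero n)) ⟩
    t i * 1#                         ≈⟨ *-identityʳ _ ⟩
    t i                              ∎

  unitPart : Carrier → Carrier
  unitPart x with x ≟ 0#
  ... | yes _ = 1#
  ... | no  _ = x

  unitPart-≉0 : ∀ x → unitPart x ≉ 0#
  unitPart-≉0 x with x ≟ 0#
  ... | yes _   = 1≉0
  ... | no  x≉0 = x≉0

  unitPart-cong : ∀ {x y} → x ≈ y → unitPart x ≈ unitPart y
  unitPart-cong {x} {y} x≈y with x ≟ 0# | y ≟ 0#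
  ... | yes _   | yes _   = refl
  ... | yes x≈0 | no  y≉0 = contradiction (trans (sym x≈y) x≈0) y≉0
  ... | no  x≉0 | yes y≈0 = contradiction (trans x≈y y≈0) x≉0
  ... | no  _   | no  _   = x≈y

  zeroFactor : Carrier → Carrier → Carrier
  zeroFactor a x with x ≟ 0#
  ... | yes _ = a
  ... | no  _ = 1#

  *-unitPart : ∀ {a} → a ≉ 0# → ∀ x → a * unitPart x ≈ unitPart (a * x) * zeroFactor a x
  *-unitPart {a} a≉0 x with x ≟ 0# | a * x ≟ 0#
  ... | yes _   | yes _    = trans (*-identityʳ a) (sym (*-identityˡ a))
  ... | yes x≈0 | no  ax≉0 = contradiction (trans (*-congˡ x≈0) (zeroʳ a)) ax≉0
  ... | no  x≉0 | yes ax≈0 = contradiction ax≈0 (*-≉0 a≉0 x≉0)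
  ... | no  _   | no  _    = sym (*-identityʳ _)

  ∏-unitPart-scale : ∀ {a} → a ≉ 0# → ∏.sum (unitPart ∘ to) ≈ ∏.sum {q} (λ i → unitPart (a * to i))
  ∏-unitPart-scale {a} a≉0 = trans (∏.sum-permute (unitPart ∘ to) π) (∏.sum-cong-≋ {q} (λ i → unitPart-cong (strictlyInverseˡ _)))
    where
    u*[v*x]≈x : ∀ {u v} → u * v ≈ 1# → ∀ x → u * (v * x) ≈ x
    u*[v*x]≈x uv≈1 x = trans (sym (*-assoc _ _ _)) (trans (*-congʳ uv≈1) (*-identityˡ x))
    π : Permutation q q
    π = permutationOf (a *_) (inv a a≉0 *_) *-congˡ *-congˡ
          (u*[v*x]≈x (x*inv≈1 a≉0)) (u*[v*x]≈x (trans (*-comm _ _) (x*inv≈1 a≉0)))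

  ∏-zeroFactor : ∀ a → ∏.sum (zeroFactor a ∘ to) ≈ a
  ∏-zeroFactor a = trans (∏-single (zeroFactor a ∘ to) (from 0#) away) at-zero
    where
    away : ∀ j → j ≢ from 0# → zeroFactor a (to j) ≈ 1#
    away j j≢0 with to j ≟ 0#
    ... | yes toj≈0 = contradiction (≡.trans (≡.sym (strictlyInverseʳ j)) (from-cong toj≈0)) j≢0
    ... | no  _     = refl
    at-zero : zeroFactor a (to (from 0#)) ≈ a
    at-zero with to (from 0#) ≟ 0#
    ... | yes _  = refl
    ... | no  ≉0 = contradiction (strictlyInverseˡ 0#) ≉0

  -- Multiplication by a ≉ 0 permutes the field; unitPart keeps the product over it nonzero, at the cost of the factor a at x = 0.
  fermat : ∀ a → a ^ᶠ q ≈ a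
  fermat a with a ≟ 0#
  ... | yes a≈0 = trans (^ᶠ-congˡ q a≈0) (trans (0^ᶠ {{Fin.nonZeroIndex (from a)}}) (sym a≈0))
  ... | no  a≉0 = *-cancelʳ (∏-≉0 (unitPart ∘ to) (unitPart-≉0 ∘ to)) (begin
    a ^ᶠ q * P                                                   ≈⟨ *-congʳ (trans (reflexive (^ᶠ≡^ a q)) (sym (∏.sum-replicate q))) ⟩
    ∏.sum {q} (λ _ → a) * P                                      ≈⟨ ∏.∑-distrib-+ (λ _ → a) (unitPart ∘ to) ⟨
    ∏.sum {q} (λ i → a * unitPart (to i))                        ≈⟨ ∏.sum-cong-≋ {q} (*-unitPart a≉0 ∘ to) ⟩
    ∏.sum {q} (λ i → unitPart (a * to i) * zeroFactor a (to i))  ≈⟨ ∏.∑-distrib-+ (λ i → unitPart (a * to i)) (zeroFactor a ∘ to) ⟩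
    ∏.sum {q} (λ i → unitPart (a * to i)) * ∏.sum {q} (zeroFactor a ∘ to)
                                                                 ≈⟨ *-cong (sym (∏-unitPart-scale a≉0)) (∏-zeroFactor a) ⟩
    P * a                                                        ≈⟨ *-comm P a ⟩
    a * P                                                        ∎)
    where
    P : Carrier
    P = ∏.sum (unitPart ∘ to)

module FieldOfPrimePowerOrder {c ℓ} (F : Field c ℓ) {p k r} (p-prime : Prime p) (1≤k : 1 ℕ.≤ k) (r≡p^k : r ≡ p ^ k)
    (n : ℕ) (enum : Inverse (≡.setoid (Fin (r ^ suc n))) (Field.setoid F)) where
  open PolynomialLemmas F
  open Counting F
  open AdditivePowers F
  open FiniteField F enum
  open import Algebra.Properties.Semiring.Mult semiring using (×1-homo-*) renaming (_×_ to _×ₙ_)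

  1<r : 1 ℕ.< r
  1<r = ℕ.<-≤-trans (ℕ.nonTrivial⇒n>1 p {{prime⇒nonTrivial p-prime}})
          (≡.subst (p ℕ.≤_) (≡.sym r≡p^k) (≡.subst (ℕ._≤ p ^ k) (ℕ.*-identityʳ p) (ℕ.^-monoʳ-≤ p {{prime⇒nonZero p-prime}} 1≤k)))

  instance
    r≢0 : ℕ.NonZero r
    r≢0 = ℕ.>-nonZero (ℕ.<-trans (s≤s z≤n) 1<r)

  1≤r^ : ∀ i → 1 ℕ.≤ r ^ i
  1≤r^ i = ℕ.m^n>0 r i

  ×1-homo-^ : ∀ j → (p ^ j) ×ₙ 1# ≈ (p ×ₙ 1#) ^ᶠ j
  ×1-homo-^ zero    = +-identityʳ 1#
  ×1-homo-^ (suc j) = trans (×1-homo-* p (p ^ j)) (*-congˡ (×1-homo-^ j))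

  characteristic : p ×ₙ 1# ≈ 0#
  characteristic with p ×ₙ 1# ≟ 0#
  ... | yes p≈0 = p≈0
  ... | no  p≉0 = contradiction (begin
    (p ×ₙ 1#) ^ᶠ (k ℕ.* suc n)  ≈⟨ ×1-homo-^ (k ℕ.* suc n) ⟨
    (p ^ (k ℕ.* suc n)) ×ₙ 1#   ≡⟨ ≡.cong (_×ₙ 1#) (≡.trans (≡.sym (ℕ.^-*-assoc p k (suc n))) (≡.cong (_^ suc n) (≡.sym r≡p^k))) ⟩
    (r ^ suc n) ×ₙ 1#           ≈⟨ q×1≈0 ⟩
    0#                          ∎) (^ᶠ-≉0 (k ℕ.* suc n) p≉0)

  additive : Additive r
  additive = ≡.subst Additive (≡.sym r≡p^k) (additive-^ (frobenius p-prime characteristic) k)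

  Xʳ-X : Poly
  Xʳ-X = Xₚ ^ₚ r -ₚ Xₚ

  monic-Xʳ-X : Monic r Xʳ-X
  monic-Xʳ-X = monic-sub-lower Xₚ (monic-X^ r) (λ i r≤i → Monic.degree monic-X i (ℕ.≤-trans 1<r r≤i))

  -- (X^r - X) · Σ_{i ≤ n} (X^r - X)^(r^i - 1) telescopes to X^(r^(n+1)) - X, which vanishes on all of F.
  outsideSubfield : Poly
  outsideSubfield = sumₚ (suc n) (λ i → Xʳ-X ^ₚ (r ^ i ℕ.∸ 1))

  monic-outsideSubfield : Monic ((r ^ n ℕ.∸ 1) ℕ.* r) outsideSubfield
  monic-outsideSubfield = monic-sumₚ (λ i → monic-^ₚ (r ^ i ℕ.∸ 1) monic-Xʳ-X)
    (λ i → ℕ.*-monoˡ-< r (ℕ.∸-monoˡ-< (ℕ.^-monoʳ-< r 1<r (ℕ.n<1+n i)) (1≤r^ i))) n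

  outsideSubfield-root : ∀ {a} → a ^ᶠ r ≉ a → IsRoot outsideSubfield a
  outsideSubfield-root {a} a^r≉a = x*y≈0⇒y≈0 (x≉y⇒x-y≉0 a^r≉a) (begin
    y * eval outsideSubfield a                               ≈⟨ *-congˡ (eval-sumₚ (suc n) _ a) ⟩
    y * sumᶠ (suc n) (λ i → eval (Xʳ-X ^ₚ (r ^ i ℕ.∸ 1)) a)  ≈⟨ *-distribˡ-sumᶠ (suc n) y _ ⟩
    sumᶠ (suc n) (λ i → y * eval (Xʳ-X ^ₚ (r ^ i ℕ.∸ 1)) a)  ≈⟨ sumᶠ-cong (suc n) step ⟩
    sumᶠ (suc n) (λ i → u (suc i) - u i)                     ≈⟨ sumᶠ-telescope (suc n) u ⟩
    u (suc n) - u 0                                          ≈⟨ +-cong (fermat a) (-‿cong (x^ᶠ1 a)) ⟩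
    a - a                                                    ≈⟨ -‿inverseʳ a ⟩
    0#                                                       ∎)
    where
    y : Carrier
    y = a ^ᶠ r - a
    u : ℕ → Carrier
    u i = a ^ᶠ (r ^ i)
    eval-Xʳ-X : eval Xʳ-X a ≈ y
    eval-Xʳ-X = trans (eval-sub (Xₚ ^ₚ r) Xₚ a) (+-cong (eval-X^ r a) (-‿cong (eval-X a)))
    step : ∀ i → y * eval (Xʳ-X ^ₚ (r ^ i ℕ.∸ 1)) a ≈ u (suc i) - u i
    step i = begin
      y * eval (Xʳ-X ^ₚ (r ^ i ℕ.∸ 1)) a  ≈⟨ *-congˡ (trans (eval-^ₚ Xʳ-X (r ^ i ℕ.∸ 1) a) (^ᶠ-congˡ (r ^ i ℕ.∸ 1) eval-Xʳ-X)) ⟩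
      y ^ᶠ suc (r ^ i ℕ.∸ 1)              ≈⟨ ^ᶠ-congʳ y (ℕ.m+[n∸m]≡n (1≤r^ i)) ⟩
      y ^ᶠ (r ^ i)                        ≈⟨ additive-sub {{ℕ.m^n≢0 r i}} (additive-^ additive i) (a ^ᶠ r) a ⟩
      (a ^ᶠ r) ^ᶠ (r ^ i) - u i           ≈⟨ +-congʳ (^ᶠ-assocʳ a r (r ^ i)) ⟩
      u (suc i) - u i                     ∎

  subfield : AtLeast r (λ t → t ^ᶠ r ≈ t)
  subfield = atLeast-map proj₂ (sieve all-elements (λ x → x ^ᶠ r ≟ x) monic-outsideSubfield
    (λ _ → outsideSubfield-root) (ℕ.≤-reflexive r+[r^n-1]r≡r^[1+n]))
    where
    r+[r^n-1]r≡r^[1+n] : r ℕ.+ (r ^ n ℕ.∸ 1) ℕ.* r ≡ r ^ suc n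
    r+[r^n-1]r≡r^[1+n] = ≡.trans (≡.cong (ℕ._+ (r ^ n ℕ.∸ 1) ℕ.* r) (≡.sym (ℕ.*-identityˡ r)))
      (≡.trans (≡.sym (ℕ.*-distribʳ-+ r 1 (r ^ n ℕ.∸ 1))) (≡.trans (≡.cong (ℕ._* r) (ℕ.m+[n∸m]≡n (1≤r^ n))) (ℕ.*-comm (r ^ n) r)))

  tracePolynomial : Poly
  tracePolynomial = sumₚ (suc n) (λ i → Xₚ ^ₚ (r ^ i))

  eval-tracePolynomial : ∀ x → eval tracePolynomial x ≈ Tr r (suc n) x
  eval-tracePolynomial x = trans (eval-sumₚ (suc n) _ x) (sumᶠ-cong (suc n) (λ i → eval-X^ (r ^ i) x))

  trace-nonvanishing : ∃ λ θ → Tr r (suc n) θ ≉ 0#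
  trace-nonvanishing with atLeast-witness (sieve all-elements (λ x → ¬? (Tr r (suc n) x ≟ 0#))
    (monic-sumₚ (λ i → monic-X^ (r ^ i)) (λ i → ℕ.^-monoʳ-< r 1<r (ℕ.n<1+n i)) n)
    (λ _ ¬Trx≉0 → trans (eval-tracePolynomial _) (decidable-stable (Tr r (suc n) _ ≟ 0#) ¬Trx≉0))
    (≡.subst (r ^ n ℕ.<_) (ℕ.*-comm (r ^ n) r) (ℕ.m<m*n (r ^ n) r {{ℕ.m^n≢0 r n}} 1<r)))
  ... | θ , _ , Trθ≉0 = θ , Trθ≉0

  hilbert90 : ∀ {c} → Tr r (suc n) c ≈ 0# → ∃ λ b → b ^ᶠ r - b ≈ c
  hilbert90 = Hilbert90.hilbert90 r (suc n) additive fermat (proj₂ trace-nonvanishing)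

[2+2m]m≡[1+m]2m : ∀ m → suc (suc (m ℕ.+ m)) ℕ.* m ≡ suc m ℕ.* (m ℕ.+ m)
[2+2m]m≡[1+m]2m = solve-∀

[1+2m]m+m≡[1+m]2m : ∀ m → suc (m ℕ.+ m) ℕ.* m ℕ.+ m ≡ suc m ℕ.* (m ℕ.+ m)
[1+2m]m+m≡[1+m]2m = solve-∀

1+[2+2m]2m≡[1+2m]² : ∀ m → suc (suc (suc (m ℕ.+ m)) ℕ.* (m ℕ.+ m)) ≡ suc (m ℕ.+ m) ℕ.* suc (m ℕ.+ m)
1+[2+2m]2m≡[1+2m]² = solve-∀

2m[1+m]≡[2+2m]m : ∀ m → (m ℕ.+ m) ℕ.* suc m ≡ suc (suc (m ℕ.+ m)) ℕ.* m
2m[1+m]≡[2+2m]m = solve-∀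

m*2≡m+m : ∀ m → m ℕ.* 2 ≡ m ℕ.+ m
m*2≡m+m = solve-∀

1+2m+1≡[1+m]*2 : ∀ m → suc (m ℕ.+ m) ℕ.+ 1 ≡ suc m ℕ.* 2
1+2m+1≡[1+m]*2 = solve-∀

[1+2m]2m≡[1+2m]m*2 : ∀ m → suc (m ℕ.+ m) ℕ.* (m ℕ.+ m) ≡ suc (m ℕ.+ m) ℕ.* m ℕ.* 2
[1+2m]2m≡[1+2m]m*2 = solve-∀

[1+2m]²≡1+2[1+m]2m : ∀ m → suc (m ℕ.+ m) ℕ.* suc (m ℕ.+ m) ≡ suc (suc m ℕ.* (m ℕ.+ m) ℕ.+ suc m ℕ.* (m ℕ.+ m))
[1+2m]²≡1+2[1+m]2m = solve-∀

2m[1+m]≡[1+2m]m+m : ∀ m → (m ℕ.+ m) ℕ.* suc m ≡ suc (m ℕ.+ m) ℕ.* m ℕ.+ m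
2m[1+m]≡[1+2m]m+m = solve-∀

module Lemma5p3 {c ℓ} (F : Field c ℓ) where
  open PolynomialLemmas F
  open AdditivePowers F using (Additive)
  open Counting F

  module Polynomial (m : ℕ) .{{_ : ℕ.NonZero m}}
      {γ e : Carrier} (γ≉0 : γ ≉ 0#)
      (e-def : e * γ ^ᶠ (suc (m ℕ.+ m) ℕ.* m) ≈ (γ ^ᶠ (m ℕ.+ m) + 1#) ^ᶠ suc m) where

    r : ℕ
    r = suc (m ℕ.+ m)

    γ²ᵐ : Carrier
    γ²ᵐ = γ ^ᶠ (m ℕ.+ m)

    instance
      2m≢0 : ℕ.NonZero (m ℕ.+ m)
      2m≢0 = ℕ.>-nonZero (ℕ.≤-trans (ℕ.>-nonZero⁻¹ m) (ℕ.m≤m+n m m))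

    eX^rm : Poly
    eX^rm = constₚ e *ₚ Xₚ ^ₚ (r ℕ.* m)

    f : Poly
    f = (X^ (m ℕ.+ m) +1) ^ₚ suc m -ₚ eX^rm

    eval-f : ∀ x → eval f x ≈ (x ^ᶠ (m ℕ.+ m) + 1#) ^ᶠ suc m - e * x ^ᶠ (r ℕ.* m)
    eval-f x = trans (eval-sub ((X^ (m ℕ.+ m) +1) ^ₚ suc m) eX^rm x) (+-cong
      (trans (eval-^ₚ (X^ (m ℕ.+ m) +1) (suc m) x) (^ᶠ-congˡ (suc m) (eval-X^+1 (m ℕ.+ m) x)))
      (-‿cong (trans (eval-*ₚ (constₚ e) (Xₚ ^ₚ (r ℕ.* m)) x) (*-cong (eval-const e x) (eval-X^ (r ℕ.* m) x)))))

    monic-f : Monic (suc m ℕ.* (m ℕ.+ m)) f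
    monic-f = monic-sub-lower eX^rm (monic-^ₚ (suc m) (monic-X^+1 (m ℕ.+ m)))
      (degree-≤ eX^rm rm<[1+m]2m (degree-*ₚ (constₚ e) (Xₚ ^ₚ (r ℕ.* m)) (degree-const e) (Monic.degree (monic-X^ (r ℕ.* m)))))
      where
      rm<[1+m]2m : r ℕ.* m ℕ.< suc m ℕ.* (m ℕ.+ m)
      rm<[1+m]2m = ≡.subst (r ℕ.* m ℕ.<_) ([1+2m]m+m≡[1+m]2m m) (ℕ.m<m+n (r ℕ.* m) (ℕ.>-nonZero⁻¹ m))

    μ-invariant : ∀ {s} z → s ^ᶠ m ≈ 1# → ∀ {d} j → m ℕ.* j ≡ d → (s * z) ^ᶠ d ≈ z ^ᶠ d
    μ-invariant {s} z s^m≈1 j ≡.refl =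
      trans (^ᶠ-distrib-* s z (m ℕ.* j)) (trans (*-congʳ (x^ᶠm≈1⇒x^ᶠ[m*n]≈1 m j s^m≈1)) (*-identityˡ _))

    root-invariant : ∀ {s z} → s ^ᶠ m ≈ 1# → IsRoot f z → IsRoot f (s * z)
    root-invariant {s} {z} s^m≈1 fz≈0 = begin
      eval f (s * z)                                                   ≈⟨ eval-f (s * z) ⟩
      ((s * z) ^ᶠ (m ℕ.+ m) + 1#) ^ᶠ suc m - e * (s * z) ^ᶠ (r ℕ.* m)  ≈⟨ +-cong (^ᶠ-congˡ (suc m) (+-congʳ (μ-invariant z s^m≈1 2 (m*2≡m+m m))))
                                                                                    (-‿cong (*-congˡ (μ-invariant z s^m≈1 r (ℕ.*-comm m r)))) ⟩
      (z ^ᶠ (m ℕ.+ m) + 1#) ^ᶠ suc m - e * z ^ᶠ (r ℕ.* m)              ≈⟨ eval-f z ⟨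
      eval f z                                                         ≈⟨ fz≈0 ⟩
      0#                                                               ∎

    [γv]ᵏWᵏ≈γᵏ : ∀ {W v} → W * v ≈ 1# → ∀ k → (γ * v) ^ᶠ k * W ^ᶠ k ≈ γ ^ᶠ k
    [γv]ᵏWᵏ≈γᵏ {W} {v} Wv≈1 k = begin
        (γ * v) ^ᶠ k * W ^ᶠ k       ≈⟨ *-congʳ (^ᶠ-distrib-* γ v k) ⟩
        (γ ^ᶠ k * v ^ᶠ k) * W ^ᶠ k  ≈⟨ *-assoc _ _ _ ⟩
        γ ^ᶠ k * (v ^ᶠ k * W ^ᶠ k)  ≈⟨ *-congˡ (trans (sym (^ᶠ-distrib-* v W k)) (trans (^ᶠ-congˡ k (trans (*-comm v W) Wv≈1)) (1^ᶠ k))) ⟩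
        γ ^ᶠ k * 1#                 ≈⟨ *-identityʳ _ ⟩
        γ ^ᶠ k                      ∎

    -- Clearing the denominator W^(2m(m+1)) turns f(γ/W) = 0 into (γ²ᵐ + W^(2m))^(m+1) = (γ²ᵐ + 1)^(m+1) W^m.
    root-γ/W : ∀ {W v A} → W * v ≈ 1# → γ²ᵐ + W ^ᶠ (m ℕ.+ m) ≈ (γ²ᵐ + 1#) * A → A ^ᶠ suc m ≈ W ^ᶠ m → IsRoot f (γ * v)
    root-γ/W {W} {v} {A} Wv≈1 γ²ᵐ+W²ᵐ≈[γ²ᵐ+1]A A^[1+m]≈Wᵐ = *-cancelʳ (^ᶠ-≉0 N W≉0) (begin
      eval f (γ * v) * W ^ᶠ N                                      ≈⟨ *-congʳ (eval-f (γ * v)) ⟩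
      (((γ * v) ^ᶠ (m ℕ.+ m) + 1#) ^ᶠ suc m - e * (γ * v) ^ᶠ (r ℕ.* m)) * W ^ᶠ N
                                                                   ≈⟨ [y-z]x≈yx-zx (W ^ᶠ N) _ _ ⟩
      ((γ * v) ^ᶠ (m ℕ.+ m) + 1#) ^ᶠ suc m * W ^ᶠ N - (e * (γ * v) ^ᶠ (r ℕ.* m)) * W ^ᶠ N
                                                                   ≈⟨ +-cong cleared-left (-‿cong cleared-right) ⟩
      (γ²ᵐ + 1#) ^ᶠ suc m * W ^ᶠ m - (γ²ᵐ + 1#) ^ᶠ suc m * W ^ᶠ m  ≈⟨ -‿inverseʳ _ ⟩
      0#                                                           ≈⟨ zeroˡ _ ⟨
      0# * W ^ᶠ N                                                  ∎)
      where
      N : ℕ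
      N = (m ℕ.+ m) ℕ.* suc m
      W≉0 : W ≉ 0#
      W≉0 W≈0 = 1≉0 (trans (sym Wv≈1) (trans (*-congʳ W≈0) (zeroˡ v)))
      scaled : ((γ * v) ^ᶠ (m ℕ.+ m) + 1#) * W ^ᶠ (m ℕ.+ m) ≈ γ²ᵐ + W ^ᶠ (m ℕ.+ m)
      scaled = trans (distribʳ _ _ _) (+-cong ([γv]ᵏWᵏ≈γᵏ Wv≈1 (m ℕ.+ m)) (*-identityˡ _))
      cleared-left : ((γ * v) ^ᶠ (m ℕ.+ m) + 1#) ^ᶠ suc m * W ^ᶠ N ≈ (γ²ᵐ + 1#) ^ᶠ suc m * W ^ᶠ m
      cleared-left = begin
        ((γ * v) ^ᶠ (m ℕ.+ m) + 1#) ^ᶠ suc m * W ^ᶠ N                     ≈⟨ *-congˡ (^ᶠ-assocʳ W (m ℕ.+ m) (suc m)) ⟨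
        ((γ * v) ^ᶠ (m ℕ.+ m) + 1#) ^ᶠ suc m * (W ^ᶠ (m ℕ.+ m)) ^ᶠ suc m  ≈⟨ ^ᶠ-distrib-* _ _ (suc m) ⟨
        (((γ * v) ^ᶠ (m ℕ.+ m) + 1#) * W ^ᶠ (m ℕ.+ m)) ^ᶠ suc m           ≈⟨ ^ᶠ-congˡ (suc m) scaled ⟩
        (γ²ᵐ + W ^ᶠ (m ℕ.+ m)) ^ᶠ suc m                                   ≈⟨ ^ᶠ-congˡ (suc m) γ²ᵐ+W²ᵐ≈[γ²ᵐ+1]A ⟩
        ((γ²ᵐ + 1#) * A) ^ᶠ suc m                                         ≈⟨ ^ᶠ-distrib-* (γ²ᵐ + 1#) A (suc m) ⟩
        (γ²ᵐ + 1#) ^ᶠ suc m * A ^ᶠ suc m                                  ≈⟨ *-congˡ A^[1+m]≈Wᵐ ⟩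
        (γ²ᵐ + 1#) ^ᶠ suc m * W ^ᶠ m                                      ∎
      cleared-right : (e * (γ * v) ^ᶠ (r ℕ.* m)) * W ^ᶠ N ≈ (γ²ᵐ + 1#) ^ᶠ suc m * W ^ᶠ m
      cleared-right = begin
        (e * (γ * v) ^ᶠ (r ℕ.* m)) * W ^ᶠ N                     ≈⟨ *-congˡ (trans (^ᶠ-congʳ W (2m[1+m]≡[1+2m]m+m m)) (^ᶠ-homo-* W (r ℕ.* m) m)) ⟩
        (e * (γ * v) ^ᶠ (r ℕ.* m)) * (W ^ᶠ (r ℕ.* m) * W ^ᶠ m)  ≈⟨ solve 4 (λ e a b c → (e :* a) :* (b :* c) := e :* (a :* b) :* c) refl e _ _ _ ⟩
        (e * ((γ * v) ^ᶠ (r ℕ.* m) * W ^ᶠ (r ℕ.* m))) * W ^ᶠ m  ≈⟨ *-congʳ (trans (*-congˡ ([γv]ᵏWᵏ≈γᵏ Wv≈1 (r ℕ.* m))) e-def) ⟩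
        (γ²ᵐ + 1#) ^ᶠ suc m * W ^ᶠ m                            ∎

    γ[γ²ᵐ+1]≈γ²ᵐ⁺¹+γ : γ * (γ²ᵐ + 1#) ≈ γ * γ²ᵐ + γ
    γ[γ²ᵐ+1]≈γ²ᵐ⁺¹+γ = trans (distribˡ γ γ²ᵐ 1#) (+-congˡ (*-identityʳ γ))

    module ArtinSchreierCoset (additive : Additive r) where

      Y : Carrier → Carrier
      Y w = (w ^ᶠ suc r) ^ᶠ (m ℕ.+ m)

      module _ {w} (w^r≈w+γ : w ^ᶠ r ≈ w + γ) where

        w≉0 : w ≉ 0#
        w≉0 w≈0 = γ≉0 (+-identityʳ-unique w γ (begin
          w + γ   ≈⟨ w^r≈w+γ ⟨
          w ^ᶠ r  ≈⟨ trans (^ᶠ-congˡ r w≈0) (0^ᶠ {r}) ⟩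
          0#      ≈⟨ w≈0 ⟨
          w       ∎))

        w*Y≈w+γ[γ²ᵐ+1] : w * Y w ≈ w + γ * (γ²ᵐ + 1#)
        w*Y≈w+γ[γ²ᵐ+1] = begin
          w * Y w                         ≈⟨ *-congˡ (^ᶠ-assocʳ w (suc r) (m ℕ.+ m)) ⟩
          w ^ᶠ suc (suc r ℕ.* (m ℕ.+ m))  ≈⟨ ^ᶠ-congʳ w (1+[2+2m]2m≡[1+2m]² m) ⟩
          w ^ᶠ (r ℕ.* r)                  ≈⟨ ^ᶠ-assocʳ w r r ⟨
          (w ^ᶠ r) ^ᶠ r                   ≈⟨ ^ᶠ-congˡ r w^r≈w+γ ⟩
          (w + γ) ^ᶠ r                    ≈⟨ additive w γ ⟩
          w ^ᶠ r + γ * γ²ᵐ                ≈⟨ +-congʳ w^r≈w+γ ⟩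
          (w + γ) + γ * γ²ᵐ               ≈⟨ solve 3 (λ w g gc → (w :+ g) :+ gc := w :+ (gc :+ g)) refl w γ (γ * γ²ᵐ) ⟩
          w + (γ * γ²ᵐ + γ)               ≈⟨ +-congˡ γ[γ²ᵐ+1]≈γ²ᵐ⁺¹+γ ⟨
          w + γ * (γ²ᵐ + 1#)              ∎

        γ²ᵐ+Y≈[γ²ᵐ+1]w²ᵐ : γ²ᵐ + Y w ≈ (γ²ᵐ + 1#) * w ^ᶠ (m ℕ.+ m)
        γ²ᵐ+Y≈[γ²ᵐ+1]w²ᵐ = *-cancelˡ w≉0 (begin
          w * (γ²ᵐ + Y w)                    ≈⟨ distribˡ w γ²ᵐ (Y w) ⟩
          w * γ²ᵐ + w * Y w                  ≈⟨ +-congˡ w*Y≈w+γ[γ²ᵐ+1] ⟩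
          w * γ²ᵐ + (w + γ * (γ²ᵐ + 1#))     ≈⟨ +-congˡ (+-congˡ γ[γ²ᵐ+1]≈γ²ᵐ⁺¹+γ) ⟩
          w * γ²ᵐ + (w + (γ * γ²ᵐ + γ))      ≈⟨ solve 3 (λ w g c → w :* c :+ (w :+ (g :* c :+ g)) := (w :+ g) :* c :+ (w :+ g)) refl w γ γ²ᵐ ⟩
          (w + γ) * γ²ᵐ + (w + γ)            ≈⟨ +-congˡ (*-identityˡ _) ⟨
          (w + γ) * γ²ᵐ + 1# * (w + γ)       ≈⟨ trans (+-congʳ (*-comm _ _)) (sym (distribʳ (w + γ) γ²ᵐ 1#)) ⟩
          (γ²ᵐ + 1#) * (w + γ)               ≈⟨ *-congˡ w^r≈w+γ ⟨
          (γ²ᵐ + 1#) * (w * w ^ᶠ (m ℕ.+ m))  ≈⟨ solve 3 (λ c w a → c :* (w :* a) := w :* (c :* a)) refl (γ²ᵐ + 1#) w _ ⟩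
          w * ((γ²ᵐ + 1#) * w ^ᶠ (m ℕ.+ m))  ∎)

        coset-root : ∀ {v} → w ^ᶠ suc r * v ≈ 1# → IsRoot f (γ * v)
        coset-root Wv≈1 = root-γ/W Wv≈1 γ²ᵐ+Y≈[γ²ᵐ+1]w²ᵐ (begin
          (w ^ᶠ (m ℕ.+ m)) ^ᶠ suc m   ≈⟨ ^ᶠ-assocʳ w (m ℕ.+ m) (suc m) ⟩
          w ^ᶠ ((m ℕ.+ m) ℕ.* suc m)  ≈⟨ ^ᶠ-congʳ w (2m[1+m]≡[2+2m]m m) ⟩
          w ^ᶠ (suc r ℕ.* m)          ≈⟨ ^ᶠ-assocʳ w (suc r) m ⟨
          (w ^ᶠ suc r) ^ᶠ m           ∎)

        Y≉1 : γ²ᵐ + 1# ≉ 0# → Y w ≉ 1#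
        Y≉1 γ²ᵐ+1≉0 Y≈1 = *-≉0 γ≉0 γ²ᵐ+1≉0 (+-identityʳ-unique w _ (begin
          w + γ * (γ²ᵐ + 1#)  ≈⟨ w*Y≈w+γ[γ²ᵐ+1] ⟨
          w * Y w             ≈⟨ trans (*-congˡ Y≈1) (*-identityʳ w) ⟩
          w                   ∎))

      Y-injective : γ²ᵐ + 1# ≉ 0# → ∀ {w w′} → w ^ᶠ r ≈ w + γ → w′ ^ᶠ r ≈ w′ + γ → w ≉ w′ → Y w ≉ Y w′
      Y-injective γ²ᵐ+1≉0 {w} {w′} w∈coset w′∈coset w≉w′ Yw≈Yw′ = Y≉1 w∈coset γ²ᵐ+1≉0 (*-cancelˡ (x≉y⇒x-y≉0 w≉w′) (begin
        (w - w′) * Y w                                ≈⟨ [y-z]x≈yx-zx (Y w) w w′ ⟩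
        w * Y w - w′ * Y w                            ≈⟨ +-congˡ (-‿cong (*-congˡ Yw≈Yw′)) ⟩
        w * Y w - w′ * Y w′                           ≈⟨ +-cong (w*Y≈w+γ[γ²ᵐ+1] w∈coset) (-‿cong (w*Y≈w+γ[γ²ᵐ+1] w′∈coset)) ⟩
        (w + γ * (γ²ᵐ + 1#)) - (w′ + γ * (γ²ᵐ + 1#))  ≈⟨ solve 3 (λ w w′ g → (w :+ g) :- (w′ :+ g) := w :- w′) refl w w′ (γ * (γ²ᵐ + 1#)) ⟩
        w - w′                                        ≈⟨ *-identityʳ _ ⟨
        (w - w′) * 1#                                 ∎))

  module Splitting {p k m} (p-prime : Prime p) (1≤k : 1 ℕ.≤ k)
      (r≡p^k : suc (m ℕ.+ m) ≡ p ^ k) (n : ℕ) (enum : Inverse (≡.setoid (Fin (suc (m ℕ.+ m) ^ suc (suc n)))) (Field.setoid F))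
      {γ e : Carrier} (γ≉0 : γ ≉ 0#) (Trγ≈0 : Tr (suc (m ℕ.+ m)) (suc (suc n)) γ ≈ 0#)
      (e-def : e * γ ^ᶠ (suc (m ℕ.+ m) ℕ.* m) ≈ (γ ^ᶠ (m ℕ.+ m) + 1#) ^ᶠ suc m) where
    open FieldOfPrimePowerOrder F p-prime 1≤k r≡p^k (suc n) enum
    open FiniteField F enum using (_≟_; _⁻¹; x*x⁻¹≈1; all-elements)

    instance
      m≢0 : ℕ.NonZero m
      m≢0 = ℕ.≢-nonZero (λ m≡0 → ℕ.<-irrefl ≡.refl (≡.subst (λ j → 1 ℕ.< suc (j ℕ.+ j)) m≡0 1<r))

    open Polynomial m γ≉0 e-def

    t^r≈t⇒t^2m≈1 : ∀ {t} → t ^ᶠ r ≈ t → t ≉ 0# → t ^ᶠ (m ℕ.+ m) ≈ 1#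
    t^r≈t⇒t^2m≈1 {t} t^r≈t t≉0 = *-cancelˡ t≉0 (trans t^r≈t (sym (*-identityʳ t)))

    subfield* : AtLeast (m ℕ.+ m) (λ t → t ^ᶠ r ≈ t × t ≉ 0#)
    subfield* = sieve subfield (λ x → ¬? (x ≟ 0#)) monic-X
      (λ _ ¬x≉0 → trans (eval-X _) (decidable-stable (_ ≟ 0#) ¬x≉0)) (ℕ.≤-reflexive (ℕ.+-comm (m ℕ.+ m) 1))

    -- An element of F_r* with s^m ≠ 1 has s^m = -1, i.e. is a root of X^m + 1.
    rootsOfUnity : AtLeast m (λ s → (s ^ᶠ r ≈ s × s ≉ 0#) × s ^ᶠ m ≈ 1#)
    rootsOfUnity = sieve subfield* (λ s → s ^ᶠ m ≟ 1#) (monic-X^+1 m)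
      (λ {s} (s^r≈s , s≉0) s^m≉1 → trans (eval-X^+1 m s) (x*y≈0⇒y≈0 (x≉y⇒x-y≉0 s^m≉1) (begin
        (s ^ᶠ m - 1#) * (s ^ᶠ m + 1#)  ≈⟨ solve 2 (λ u o → (u :- o) :* (u :+ o) := u :* u :- o :* o) refl (s ^ᶠ m) 1# ⟩
        s ^ᶠ m * s ^ᶠ m - 1# * 1#      ≈⟨ +-cong (trans (sym (^ᶠ-homo-* s m m)) (t^r≈t⇒t^2m≈1 s^r≈s s≉0)) (-‿cong (*-identityˡ 1#)) ⟩
        1# - 1#                        ≈⟨ -‿inverseʳ 1# ⟩
        0#                             ∎)))
      (ℕ.≤-refl)

    module Generic (γ²ᵐ+1≉0 : γ²ᵐ + 1# ≉ 0#) where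
      open ArtinSchreierCoset additive
      open Orbits F

      b : Carrier
      b = proj₁ (hilbert90 Trγ≈0)

      b^r≈b+γ : b ^ᶠ r ≈ b + γ
      b^r≈b+γ = begin
        b ^ᶠ r            ≈⟨ solve 2 (λ x b → x := (x :- b) :+ b) refl (b ^ᶠ r) b ⟩
        (b ^ᶠ r - b) + b  ≈⟨ +-congʳ (proj₂ (hilbert90 Trγ≈0)) ⟩
        γ + b             ≈⟨ +-comm γ b ⟩
        b + γ             ∎

      b+t-in-coset : ∀ {t} → t ^ᶠ r ≈ t → (b + t) ^ᶠ r ≈ (b + t) + γ
      b+t-in-coset {t} t^r≈t = begin
        (b + t) ^ᶠ r     ≈⟨ additive b t ⟩
        b ^ᶠ r + t ^ᶠ r  ≈⟨ +-cong b^r≈b+γ t^r≈t ⟩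
        (b + γ) + t      ≈⟨ solve 3 (λ b g t → (b :+ g) :+ t := (b :+ t) :+ g) refl b γ t ⟩
        (b + t) + γ      ∎

      ts : List Carrier
      ts = AtLeast.witnesses subfield

      -- W = 1 plays the role of the point at infinity of the coset b + F_r.
      Ws : List Carrier
      Ws = 1# ∷ map (λ t → (b + t) ^ᶠ suc r) ts

      ts-in-coset : All (λ t → (b + t) ^ᶠ r ≈ (b + t) + γ) ts
      ts-in-coset = All.map b+t-in-coset (AtLeast.witnesses-satisfy subfield)

      Ws-≉0 : All (_≉ 0#) Ws
      Ws-≉0 = 1≉0 ∷ All.map⁺ (All.map (λ w∈coset → ^ᶠ-≉0 (suc r) (w≉0 w∈coset)) ts-in-coset)

      Ws-apart : AllPairs.AllPairs (λ W W′ → W ^ᶠ (m ℕ.+ m) ≉ W′ ^ᶠ (m ℕ.+ m)) Ws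
      Ws-apart = All.map⁺ (All.map (λ w∈coset 1≈Y → Y≉1 w∈coset γ²ᵐ+1≉0 (trans (sym 1≈Y) (1^ᶠ (m ℕ.+ m)))) ts-in-coset)
               ∷ AllPairs.map⁺ (AllPairs-restrict ts-in-coset (AllPairs.map (λ t≉t′ → t≉t′ ∘ +-cancelˡ b _ _) (AtLeast.witnesses-distinct subfield))
                   (Y-injective γ²ᵐ+1≉0))

      Ws-roots : All (λ W → IsRoot f (γ * W ⁻¹)) Ws
      Ws-roots = root-γ/W (x*x⁻¹≈1 1≉0) (trans (+-congˡ (1^ᶠ (m ℕ.+ m))) (sym (*-identityʳ _))) (trans (1^ᶠ (suc m)) (sym (1^ᶠ m)))
               ∷ All.map⁺ (All.map (λ w∈coset → coset-root w∈coset (x*x⁻¹≈1 (^ᶠ-≉0 (suc r) (w≉0 w∈coset)))) ts-in-coset)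

      zs : List Carrier
      zs = map (λ W → γ * W ⁻¹) Ws

      z≉0 : ∀ {W} → W ≉ 0# → γ * W ⁻¹ ≉ 0#
      z≉0 W≉0 = *-≉0 γ≉0 (λ W⁻¹≈0 → 1≉0 (trans (sym (x*x⁻¹≈1 W≉0)) (trans (*-congˡ W⁻¹≈0) (zeroʳ _))))

      zs-apart : AllPairs.AllPairs (λ z z′ → z ^ᶠ (m ℕ.+ m) ≉ z′ ^ᶠ (m ℕ.+ m)) zs
      zs-apart = AllPairs.map⁺ (AllPairs-restrict Ws-≉0 Ws-apart λ {W} {W′} W≉0 W′≉0 W²ᵐ≉W′²ᵐ z²ᵐ≈z′²ᵐ →
        W²ᵐ≉W′²ᵐ (*-cancelˡ (^ᶠ-≉0 (m ℕ.+ m) (z≉0 W≉0)) (begin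
          (γ * W ⁻¹) ^ᶠ (m ℕ.+ m) * W ^ᶠ (m ℕ.+ m)    ≈⟨ [γv]ᵏWᵏ≈γᵏ (x*x⁻¹≈1 W≉0) (m ℕ.+ m) ⟩
          γ²ᵐ                                         ≈⟨ [γv]ᵏWᵏ≈γᵏ (x*x⁻¹≈1 W′≉0) (m ℕ.+ m) ⟨
          (γ * W′ ⁻¹) ^ᶠ (m ℕ.+ m) * W′ ^ᶠ (m ℕ.+ m)  ≈⟨ *-congʳ z²ᵐ≈z′²ᵐ ⟨
          (γ * W ⁻¹) ^ᶠ (m ℕ.+ m) * W′ ^ᶠ (m ℕ.+ m)   ∎)))

      ss : List Carrier
      ss = AtLeast.witnesses rootsOfUnity

      ss^m≈1 : All (λ s → s ^ᶠ m ≈ 1#) ss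
      ss^m≈1 = All.map proj₂ (AtLeast.witnesses-satisfy rootsOfUnity)

      roots : List Carrier
      roots = orbits zs ss

      length-roots : length roots ≡ suc m ℕ.* (m ℕ.+ m)
      length-roots = ≡.trans (length-orbits zs ss) (≡.trans
        (≡.cong₂ ℕ._*_ (≡.cong suc (≡.trans (List.length-map _ (map _ ts)) (≡.trans (List.length-map _ ts) (AtLeast.length-witnesses subfield))))
                       (AtLeast.length-witnesses rootsOfUnity))
        ([2+2m]m≡[1+m]2m m))

      roots-distinct : Distinct roots
      roots-distinct = orbits-distinct (m ℕ.+ m) zs-apart (All.map⁺ (All.map z≉0 Ws-≉0)) (AtLeast.witnesses-distinct rootsOfUnity)
        (All.map (λ {s} s^m≈1 → trans (^ᶠ-congʳ s (≡.sym (m*2≡m+m m))) (x^ᶠm≈1⇒x^ᶠ[m*n]≈1 m 2 s^m≈1)) ss^m≈1)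

      roots-are-roots : All (IsRoot f) roots
      roots-are-roots = All-orbits (All.map⁺ Ws-roots) ss^m≈1 (λ fz≈0 s^m≈1 → root-invariant s^m≈1 fz≈0)

      splits : Splits f
      splits = 1# , roots , monic-roots⇒≈ₚ f roots monic-f length-roots roots-distinct roots-are-roots

    module Degenerate (γ²ᵐ+1≈0 : γ²ᵐ + 1# ≈ 0#) where

      e≈0 : e ≈ 0#
      e≈0 = *-cancelʳ (^ᶠ-≉0 (r ℕ.* m) γ≉0) (begin
        e * γ ^ᶠ (r ℕ.* m)   ≈⟨ e-def ⟩
        (γ²ᵐ + 1#) ^ᶠ suc m  ≈⟨ trans (^ᶠ-congˡ (suc m) γ²ᵐ+1≈0) (0^ᶠ {suc m}) ⟩
        0#                   ≈⟨ zeroˡ _ ⟨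
        0# * γ ^ᶠ (r ℕ.* m)  ∎)

      R₀ : List Carrier
      R₀ = map (γ *_) (AtLeast.witnesses subfield*)

      X²ᵐ+1-splits : X^ (m ℕ.+ m) +1 ≈ₚ 1ₚ *ₚ prodₚ (map linear R₀)
      X²ᵐ+1-splits = monic-roots⇒≈ₚ (X^ (m ℕ.+ m) +1) R₀ (monic-X^+1 (m ℕ.+ m))
        (≡.trans (List.length-map (γ *_) (AtLeast.witnesses subfield*)) (AtLeast.length-witnesses subfield*))
        (AllPairs.map⁺ (AllPairs.map (λ t≉t′ → t≉t′ ∘ *-cancelˡ γ≉0) (AtLeast.witnesses-distinct subfield*)))
        (All.map⁺ (All.map (λ {t} (t^r≈t , t≉0) → begin
          eval (X^ (m ℕ.+ m) +1) (γ * t)  ≈⟨ eval-X^+1 (m ℕ.+ m) (γ * t) ⟩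
          (γ * t) ^ᶠ (m ℕ.+ m) + 1#       ≈⟨ +-congʳ (trans (^ᶠ-distrib-* γ t (m ℕ.+ m)) (*-congˡ (t^r≈t⇒t^2m≈1 t^r≈t t≉0))) ⟩
          γ²ᵐ * 1# + 1#                   ≈⟨ trans (+-congʳ (*-identityʳ γ²ᵐ)) γ²ᵐ+1≈0 ⟩
          0#                              ∎) (AtLeast.witnesses-satisfy subfield*)))

      R : List Carrier
      R = concat (replicate (suc m) R₀)

      length-R : length R ≡ suc m ℕ.* (m ℕ.+ m)
      length-R = length-concat-replicate (suc m)
        where
        length-concat-replicate : ∀ j → length (concat (replicate j R₀)) ≡ j ℕ.* (m ℕ.+ m)
        length-concat-replicate zero    = ≡.refl
        length-concat-replicate (suc j) = ≡.trans (List.length-++ R₀)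
          (≡.cong₂ ℕ._+_ (≡.trans (List.length-map (γ *_) (AtLeast.witnesses subfield*)) (AtLeast.length-witnesses subfield*))
                         (length-concat-replicate j))

      g : Poly
      g = 1ₚ *ₚ prodₚ (map linear R)

      eval-1ₚ*ₚ : ∀ p x → eval (1ₚ *ₚ p) x ≈ eval p x
      eval-1ₚ*ₚ p x = trans (eval-*ₚ 1ₚ p x) (trans (*-congʳ (eval-const 1# x)) (*-identityˡ _))

      eval-prod-replicate : ∀ j x → eval (prodₚ (map linear (concat (replicate j R₀)))) x ≈ eval (prodₚ (map linear R₀)) x ^ᶠ j
      eval-prod-replicate zero    x = eval-const 1# x
      eval-prod-replicate (suc j) x = trans (eval-prod-linear-++ R₀ (concat (replicate j R₀)) x) (*-congˡ (eval-prod-replicate j x))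

      x²ᵐ+1≈∏ : ∀ x → x ^ᶠ (m ℕ.+ m) + 1# ≈ eval (prodₚ (map linear R₀)) x
      x²ᵐ+1≈∏ x = begin
        x ^ᶠ (m ℕ.+ m) + 1#                   ≈⟨ eval-X^+1 (m ℕ.+ m) x ⟨
        eval (X^ (m ℕ.+ m) +1) x              ≈⟨ eval-≈ₚ (X^ (m ℕ.+ m) +1) (1ₚ *ₚ prodₚ (map linear R₀)) X²ᵐ+1-splits x ⟩
        eval (1ₚ *ₚ prodₚ (map linear R₀)) x  ≈⟨ eval-1ₚ*ₚ (prodₚ (map linear R₀)) x ⟩
        eval (prodₚ (map linear R₀)) x        ∎

      f≈g-pointwise : ∀ x → eval f x ≈ eval g x
      f≈g-pointwise x = begin
        eval f x                                             ≈⟨ eval-f x ⟩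
        (x ^ᶠ (m ℕ.+ m) + 1#) ^ᶠ suc m - e * x ^ᶠ (r ℕ.* m)  ≈⟨ +-congˡ (trans (-‿cong (trans (*-congʳ e≈0) (zeroˡ _))) -0#≈0#) ⟩
        (x ^ᶠ (m ℕ.+ m) + 1#) ^ᶠ suc m + 0#                  ≈⟨ +-identityʳ _ ⟩
        (x ^ᶠ (m ℕ.+ m) + 1#) ^ᶠ suc m                       ≈⟨ ^ᶠ-congˡ (suc m) (x²ᵐ+1≈∏ x) ⟩
        eval (prodₚ (map linear R₀)) x ^ᶠ suc m              ≈⟨ eval-prod-replicate (suc m) x ⟨
        eval (prodₚ (map linear R)) x                        ≈⟨ eval-1ₚ*ₚ (prodₚ (map linear R)) x ⟨
        eval g x                                             ∎

      points : AtLeast (suc (suc m ℕ.* (m ℕ.+ m))) U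
      points = atLeast-≤ (ℕ.≤-trans (≡.subst (suc (suc m ℕ.* (m ℕ.+ m)) ℕ.≤_) (≡.sym ([1+2m]²≡1+2[1+m]2m m)) (s≤s (ℕ.m≤m+n _ _)))
                                    (ℕ.*-monoʳ-≤ r (ℕ.m≤m*n r (r ^ n) {{ℕ.m^n≢0 r n}}))) all-elements

      splits : Splits f
      splits = 1# , R , ≈ₚ-from-eval f g (AtLeast.witnesses points) (AtLeast.length-witnesses points)
        (Monic.degree monic-f) (Monic.degree (≡.subst (λ d → Monic d g) length-R (monic-*ₚ monic-1 (monic-prod-linear R))))
        (AtLeast.witnesses-distinct points) (All.tabulate (λ {x} _ → f≈g-pointwise x))

    splits : Splits f
    splits with γ²ᵐ + 1# ≟ 0#
    ... | yes γ²ᵐ+1≈0 = Degenerate.splits γ²ᵐ+1≈0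
    ... | no  γ²ᵐ+1≉0 = Generic.splits γ²ᵐ+1≉0

2∤p^k : ∀ {p} → Prime p → p ≢ 2 → ∀ k → ¬ 2 ∣ p ^ k
2∤p^k p-prime p≢2 zero    2∣1 = contradiction (∣1⇒≡1 2∣1) λ ()
2∤p^k p-prime p≢2 (suc k) 2∣p^[1+k] with euclidsLemma _ (_ ^ k) prime[2] 2∣p^[1+k]
... | inj₂ 2∣p^k = 2∤p^k p-prime p≢2 k 2∣p^k
... | inj₁ 2∣p with prime⇒irreducible p-prime 2∣p
...   | inj₁ ()
...   | inj₂ 2≡p = p≢2 (≡.sym 2≡p)

odd⇒≡1+2m : ∀ {n} → ¬ 2 ∣ n → ∃ λ m → n ≡ suc (m +ℕ m)
odd⇒≡1+2m {n} 2∤n with n % 2 in n%2≡ | m%n<n n 2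
... | 0 | _ = contradiction (m%n≡0⇒n∣m n 2 n%2≡) 2∤n
... | 1 | _ = n / 2 , ≡.trans (m≡m%n+[m/n]*n n 2) (≡.cong₂ _+ℕ_ n%2≡ (m*2≡m+m (n / 2)))
... | suc (suc _) | s≤s (s≤s ())

[r+1]/2≡1+m : ∀ m → (suc (m +ℕ m) +ℕ 1) / 2 ≡ suc m
[r+1]/2≡1+m m = ≡.trans (≡.cong (_/ 2) (1+2m+1≡[1+m]*2 m)) (m*n/n≡m (suc m) 2)

r[r-1]/2≡rm : ∀ m → (suc (m +ℕ m) *ℕ (m +ℕ m)) / 2 ≡ suc (m +ℕ m) *ℕ m
r[r-1]/2≡rm m = ≡.trans (≡.cong (_/ 2) ([1+2m]2m≡[1+2m]m*2 m)) (m*n/n≡m (suc (m +ℕ m) *ℕ m) 2)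

lemma5p3 : ∀ {c ℓ} (F : Field c ℓ) (p k r n Q : ℕ)
    → Prime p → p ≢ 2
    → 1 ≤ k → r ≡ p ^ k
    → 1 ≤ n → Q ≡ r ^ n
    → Inverse (setoid (Fin Q)) (Field.setoid F)
    → let open FieldPoly F in
    ∀ (γ : Carrier) → ¬ (γ ≈ 0#) → Tr r n γ ≈ 0#
    → ∀ (e : Carrier)
    → e * γ ^ᶠ ((r *ℕ (r ∸ 1)) / 2) ≈ (γ ^ᶠ (r ∸ 1) + 1#) ^ᶠ ((r +ℕ 1) / 2)
    → Splits ((Xₚ ^ₚ (r ∸ 1) +ₚ 1ₚ) ^ₚ ((r +ℕ 1) / 2)
    -ₚ constₚ e *ₚ Xₚ ^ₚ ((r *ℕ (r ∸ 1)) / 2))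
lemma5p3 F _ _ _ 1 _ _ _ _ _ _ _ _ γ γ≉0 Trγ≈0 _ _ =
  -- For n = 1 the trace is the identity map.
  contradiction (trans (sym (trans (+-identityˡ _) (*-identityʳ γ))) Trγ≈0) γ≉0
  where open Field F
lemma5p3 F _ k _ (suc (suc n)) _ p-prime p≢2 1≤k r≡p^k _ ≡.refl enum _ γ≉0 Trγ≈0 _ e-def
  with m , p^k≡1+2m ← odd⇒≡1+2m (2∤p^k p-prime p≢2 k)
  with ≡.refl ← ≡.trans r≡p^k p^k≡1+2m
  rewrite [r+1]/2≡1+m m | r[r-1]/2≡rm m
  = Lemma5p3.Splitting.splits F {m = m} p-prime 1≤k r≡p^k n enum γ≉0 Trγ≈0 e-def
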